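{- For any non-empty index $\boldsymbol{k}$ and any non-negative integer $m$, \begin{align*} h_m((1);t) &=(1)\oplus(m),\\ h_m(\boldsymbol{k}_{\uparrow};t) &=h_m(\boldsymbol{k};t)_{\uparrow}+th_{m-1}(\boldsymbol{k}_{\uparrow};t)_{\uparrow},\\ h_m(\boldsymbol{k}_{\rightarrow};t) & =h_m(\boldsymbol{k};t)_{\uparrow}+h_m(\boldsymbol{k};t)_{\rightarrow}-(1-t)h_m(\boldsymbol{k}_{\uparrow};t)+(1-t)h_{m-1}(\boldsymbol{k}_{\rightarrow\uparrow};t). \end{align*}
   Context: Indices are tuples of positive integers; $\mathrm{wt}$ is the sum of entries, $\mathrm{dep}$ the number of entries, $\oplus$ componentwise addition. For a non-empty index $\boldsymbol{k}=(k_1,\dots,k_r)$, $\boldsymbol{k}_{\uparrow}=(k_1,\dots,k_{r-1},k_r+1)$ and $\boldsymbol{k}_{\rightarrow}=(k_1,\dots,k_r,1)$; these operations are extended $\mathbb{Q}[t]$-linearly to formal $\mathbb{Q}[t]$-linear combinations of non-empty indices. Binomial coefficients with integer (possibly negative) top are $\binom{n}{j}=n(n-1)\cdots(n-j+1)/j!$. For $m\ge0$, $h_m(\boldsymbol{k};t)=\sum_{l=1}^{r}\sum_{e_1+\cdots+e_l+e'_1+\cdots+e'_l=m,\ e_i,e'_i\ge0} t^{r-l+e_1+\cdots+e_l}\sum_{\boldsymbol{k}=(\boldsymbol{k}_1,\dots,\boldsymbol{k}_l),\ \mathrm{dep}(\boldsymbol{k}_i)>0}\prod_{l'=1}^{l}\binom{\mathrm{wt}(\boldsymbol{k}_{l'})-\mathrm{dep}(\boldsymbol{k}_{l'})+e_{l'}+\delta_{l',1}-2}{e_{l'}}\times\bigl((\mathrm{wt}(\boldsymbol{k}_1),\dots,\mathrm{wt}(\boldsymbol{k}_l))\oplus\boldsymbol{e}\oplus\boldsymbol{e}'\bigr)$,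 the inner sum over decompositions of $\boldsymbol{k}$ into consecutive non-empty blocks; and $h_{ -1}(\boldsymbol{k};t)=0$. -}

module Defs where

open import Data.Nat as ℕ using (ℕ; zero; suc; _∸_; _!)
open import Data.Nat.Properties using (_!≢0)
open import Data.Integer as ℤ using (ℤ; +_)
open import Data.Rational as ℚ using (ℚ)
open import Data.Nat.ListAction using (sum)
open import Data.List using (List; []; _∷_; [_]; map; concatMap; upTo; length; take; drop; foldr; zipWith; filter)
open import Data.List.Properties using (≡-dec)
open import Data.Bool using (Bool; true; false; if_then_else_)
open import Data.Product using (_×_; _,_)
open import Relation.Binary.PropositionalEquality using (_≡_)
open import Relation.Nullary.Decidable using (⌊_⌋; _×-dec_)

-- Indices: tuples of (positive) natural numbers, represented as lists.

Index : Set
Index = List ℕ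

wt : Index → ℕ
wt = sum

dep : Index → ℕ
dep = length

-- Formal ℚ[t]-linear combinations of indices.
-- A term  c · t^p · k  is stored as a triple (c , p , k); a linear
-- combination is a finite list of terms (a formal sum).

Term : Set
Term = ℚ × ℕ × Index

LC : Set
LC = List Term

coeff : LC → ℕ → Index → ℚ
coeff []                  p κ = ℚ.0ℚ
coeff ((c , q , k) ∷ xs)  p κ =
  (if ⌊ (q ℕ.≟ p) ×-dec (≡-dec ℕ._≟_ k κ) ⌋ then c else ℚ.0ℚ) ℚ.+ coeff xs p κ

infix 4 _≈_
_≈_ : LC → LC → Set
X ≈ Y = ∀ (p : ℕ) (κ : Index) → coeff X p κ ≡ coeff Y p κ

infixl 6 _⊕ₗ_ _⊖ₗ_
_⊕ₗ_ : LC → LC → LC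
X ⊕ₗ Y = X Data.List.++ Y

negₗ : LC → LC
negₗ = map (λ { (c , p , k) → (ℚ.- c , p , k) })

_⊖ₗ_ : LC → LC → LC
X ⊖ₗ Y = X ⊕ₗ negₗ Y

tₗ : LC → LC
tₗ = map (λ { (c , p , k) → (c , suc p , k) })

oneMinusT : LC → LC
oneMinusT X = X ⊖ₗ tₗ X

single : Index → LC
single k = [ (ℚ.1ℚ , 0 , k) ]

-- k↑ and k→ on indices (only meaningful for non-empty indices; on the
-- empty index they are given arbitrary values, never used), extended
-- linearly to formal combinations.

up : Index → Index
up []           = []
up (x ∷ [])     = suc x ∷ []
up (x ∷ y ∷ ys) = x ∷ up (y ∷ ys)

right : Index → Index
right k = k Data.List.++ [ 1 ]

upₗ : LC → LC
upₗ = map (λ { (c , p , k) → (c , p , up k) })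

rightₗ : LC → LC
rightₗ = map (λ { (c , p , k) → (c , p , right k) })

falling : ℤ → ℕ → ℤ
falling n zero    = + 1
falling n (suc j) = falling n j ℤ.* (n ℤ.- (+ j))

binom : ℤ → ℕ → ℚ
binom n j = (falling n j ℚ./ (j !)) {{j !≢0}}

-- Decompositions of a list into consecutive non-empty blocks.

joinFirst : {A : Set} → A → List (List A) → List (List (List A))
joinFirst x []       = []
joinFirst x (b ∷ bs) = [ (x ∷ b) ∷ bs ]

blocks : {A : Set} → List A → List (List (List A))
blocks []       = [ [] ]
blocks (x ∷ xs) = concatMap (λ d → ([ x ] ∷ d) ∷ joinFirst x d) (blocks xs)

weakComps : ℕ → ℕ → List (List ℕ)
weakComps zero    zero    = [ [] ]
weakComps zero    (suc m) = []
weakComps (suc n) m =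
  concatMap (λ a → map (a ∷_) (weakComps n (m ∸ a))) (upTo (suc m))

-- δ_{l',1} - 2 + (wt - dep + e) encoded as an integer;
-- the Bool says whether the block is the first one.
binTop : Bool → Index → ℕ → ℤ
binTop first b e =
  (+ (wt b ∸ dep b ℕ.+ e ℕ.+ (if first then 1 else 0))) ℤ.- (+ 2)

prodBinoms : Bool → List Index → List ℕ → ℚ
prodBinoms first (b ∷ bs) (e ∷ es) =
  binom (binTop first b e) e ℚ.* prodBinoms false bs es
prodBinoms first _ _ = ℚ.1ℚ

zipWith3 : {A B C D : Set} → (A → B → C → D) → List A → List B → List C → List D
zipWith3 f (a ∷ as) (b ∷ bs) (c ∷ cs) = f a b c ∷ zipWith3 f as bs cs
zipWith3 f _ _ _ = []

-- contribution of one decomposition bs and one splitting (e , e')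
hTerm : Index → List Index → List ℕ → Term
hTerm k bs v =
  let l  = length bs
      e  = take l v
      e' = drop l v
  in ( prodBinoms true bs e
     , dep k ∸ l ℕ.+ sum e
     , zipWith3 (λ b x y → wt b ℕ.+ x ℕ.+ y) bs e e' )

-- h m k  is  h_m(k; t);  the l = 0 decomposition (only present for
-- the empty index) is excluded, matching the sum over l = 1..r.
hDecomp : ℕ → Index → List Index → LC
hDecomp m k []        = []
hDecomp m k (b ∷ bs)  =
  map (hTerm k (b ∷ bs)) (weakComps (2 ℕ.* length (b ∷ bs)) m)

h : ℕ → Index → LC
h m k = concatMap (hDecomp m k) (blocks k)

-- h₋ m k  is  h_{m-1}(k; t), with h_{-1} = 0
h₋ : ℕ → Index → LC
h₋ zero    k = []
h₋ (suc m) k = h m k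

{-# OPTIONS --safe #-}
-- A term of h_m(k;t) is indexed by a decomposition of k into blocks and a weak
-- composition (e, e′) of m. The decompositions of k↑ are those of k with the last
-- block raised; those of k→ are those of k with either a new last block (1) or the
-- entry 1 appended to the last block. Both sides are compared one decomposition at
-- a time, splitting the weak compositions by whether the entries of the last block
-- vanish. For k↑, Pascal's rule for the binomial coefficient of the last block
-- produces the t-shifted terms. For k→, appending 1 to the last block just shifts a
-- term of k by t and ↑, while a new block (1) with e-entry x carries binom(x - 2, x),
-- which is 1 for x = 0, -1 for x = 1 and 0 otherwise: the case x = 0 gives h_m(k;t)→
-- and, together with x = 1, the correction (1 - t) h_{m-1}(k→↑;t).
module Submission where

open import Defs
open import Data.Nat as ℕ using (ℕ; zero; suc; _∸_; _≤_; _<_; z≤n; s≤s; NonZero; _!)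
import Data.Nat.Properties as ℕP
open import Data.Integer as ℤ using (ℤ; +_)
import Data.Integer.Properties as ℤP
open import Data.Integer.Tactic.RingSolver using (solve-∀)
open import Data.Rational as ℚ using (ℚ)
import Data.Rational.Properties as ℚP
import Data.Rational.Unnormalised as ℚᵘ
import Data.Rational.Unnormalised.Properties as ℚᵘP
open import Data.Rational.Solver using (module +-*-Solver)
open +-*-Solver using (solve; _:+_; :-_; _:=_)
open import Data.List using (List; []; _∷_; [_]; map; concatMap; _++_; length; take; drop; upTo; applyUpTo; replicate; initLast; _∷ʳ′_)
import Data.List.Properties as LP
open import Data.List.Relation.Unary.All as All using (All; []; _∷_)
import Data.List.Relation.Unary.All.Properties as AllP
open import Data.Bool using (Bool; true; false; if_then_else_)
open import Data.Sum using (inj₁; inj₂)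
open import Data.Product using (_×_; _,_; ∃₂)
open import Data.Unit using (⊤)
open import Data.Nat.ListAction using (sum)
open import Data.Nat.ListAction.Properties using (sum-++)
open import Data.Empty using (⊥-elim)
open import Function using (_∘_)
open import Relation.Binary.Bundles using (Setoid)
open import Relation.Binary.Structures using (IsEquivalence)
open import Algebra.Structures using (IsCommutativeSemigroup)
open import Algebra.Bundles using (CommutativeSemigroup)
import Relation.Binary.Reasoning.Setoid as SetoidReasoning
open import Relation.Binary.PropositionalEquality hiding ([_])
open import Relation.Nullary.Decidable using (⌊_⌋; _×-dec_; isYes≗does)

private variable
  A B C : Set

-- Binomial coefficients

falling-suc : ∀ n j → falling (ℤ.suc n) (suc j) ≡ ℤ.suc n ℤ.* falling n j
falling-suc n zero = base n
  where
  base : ∀ n → + 1 ℤ.* ((+ 1 ℤ.+ n) ℤ.- + 0) ≡ (+ 1 ℤ.+ n) ℤ.* + 1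
  base = solve-∀
falling-suc n (suc j) = begin
  falling (ℤ.suc n) (suc j) ℤ.* (ℤ.suc n ℤ.- + suc j)
    ≡⟨ cong₂ ℤ._*_ (falling-suc n j) (shift n (+ j)) ⟩
  (ℤ.suc n ℤ.* falling n j) ℤ.* (n ℤ.- + j)
    ≡⟨ ℤP.*-assoc (ℤ.suc n) (falling n j) (n ℤ.- + j) ⟩
  ℤ.suc n ℤ.* falling n (suc j) ∎
  where
  open ≡-Reasoning
  shift : ∀ n j → (+ 1 ℤ.+ n) ℤ.- (+ 1 ℤ.+ j) ≡ n ℤ.- j
  shift = solve-∀

falling-vanishes : ∀ x j → x < j → falling (+ x) j ≡ + 0
falling-vanishes x (suc j) (s≤s x≤j) with ℕP.m≤n⇒m<n∨m≡n x≤j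
... | inj₁ x<j  = trans (cong (ℤ._* (+ x ℤ.- + j)) (falling-vanishes x j x<j)) (ℤP.*-zeroˡ (+ x ℤ.- + j))
... | inj₂ refl = trans (cong (falling (+ x) x ℤ.*_) (ℤP.+-inverseʳ (+ x))) (ℤP.*-zeroʳ (falling (+ x) x))

binom-vanishes : ∀ x j → x < j → binom (+ x) j ≡ ℚ.0ℚ
binom-vanishes x j x<j =
  trans (cong (λ f → (f ℚ./ (j !)) {{j ℕP.!≢0}}) (falling-vanishes x j x<j))
        (ℚP.0/n≡0 (j !) {{j ℕP.!≢0}})

private
  cross-multiply : ∀ (b c : ℤ) (s d : ℕ) → let S = + suc s; D = + suc d; sd = suc s ℕ.* suc d in
    (b ℤ.* D ℤ.+ c ℤ.* + sd) ℤ.* + sd ≡ (b ℤ.+ S ℤ.* c) ℤ.* + (sd ℕ.* suc d)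
  cross-multiply b c s d = begin
    (b ℤ.* D ℤ.+ c ℤ.* + sd) ℤ.* + sd           ≡⟨ cong (λ x → (b ℤ.* D ℤ.+ c ℤ.* x) ℤ.* x) sd≡S*D ⟩
    (b ℤ.* D ℤ.+ c ℤ.* (S ℤ.* D)) ℤ.* (S ℤ.* D) ≡⟨ expand b c S D ⟩
    (b ℤ.+ S ℤ.* c) ℤ.* (S ℤ.* D ℤ.* D)         ≡⟨ cong ((b ℤ.+ S ℤ.* c) ℤ.*_) (trans (cong (ℤ._* D) sd≡S*D) (ℤP.pos-* sd (suc d))) ⟨
    (b ℤ.+ S ℤ.* c) ℤ.* + (sd ℕ.* suc d)        ∎
    where
    open ≡-Reasoning
    S = + suc s
    D = + suc d
    sd = suc s ℕ.* suc d
    sd≡S*D : + sd ≡ S ℤ.* D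
    sd≡S*D = ℤP.pos-* (suc s) (suc d)
    expand : ∀ b c S D → (b ℤ.* D ℤ.+ c ℤ.* (S ℤ.* D)) ℤ.* (S ℤ.* D) ≡ (b ℤ.+ S ℤ.* c) ℤ.* (S ℤ.* D ℤ.* D)
    expand = solve-∀

[b+sc]/sd≡b/sd+c/d : ∀ (a b c : ℤ) (s d : ℕ) → a ≡ b ℤ.+ + suc s ℤ.* c →
  a ℚ./ (suc s ℕ.* suc d) ≡ b ℚ./ (suc s ℕ.* suc d) ℚ.+ c ℚ./ suc d
[b+sc]/sd≡b/sd+c/d a b c s d refl = ℚP.toℚᵘ-injective (begin
  ℚ.toℚᵘ (a ℚ./ suc sd-1)                           ≈⟨ toℚᵘ-/ a sd-1 ⟩
  ℚᵘ.mkℚᵘ a sd-1                                    ≈⟨ ℚᵘ.*≡* (cross-multiply b c s d) ⟨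
  ℚᵘ.mkℚᵘ b sd-1 ℚᵘ.+ ℚᵘ.mkℚᵘ c d                  ≈⟨ ℚᵘP.+-cong (toℚᵘ-/ b sd-1) (toℚᵘ-/ c d) ⟨
  ℚ.toℚᵘ (b ℚ./ suc sd-1) ℚᵘ.+ ℚ.toℚᵘ (c ℚ./ suc d) ≈⟨ ℚP.toℚᵘ-homo-+ (b ℚ./ suc sd-1) (c ℚ./ suc d) ⟨
  ℚ.toℚᵘ (b ℚ./ suc sd-1 ℚ.+ c ℚ./ suc d)           ∎)
  where
  open SetoidReasoning ℚᵘP.≃-setoid
  sd-1 = d ℕ.+ s ℕ.* suc d
  toℚᵘ-/ : ∀ a d → ℚ.toℚᵘ (a ℚ./ suc d) ℚᵘ.≃ ℚᵘ.mkℚᵘ a d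
  toℚᵘ-/ a d = ℚP.toℚᵘ-fromℚᵘ (ℚᵘ.mkℚᵘ a d)

binom-pascal : ∀ n j → binom (ℤ.suc n) (suc j) ≡ binom n (suc j) ℚ.+ binom n j
binom-pascal n j = begin
  falling (ℤ.suc n) (suc j) / (suc j ℕ.* j !)
    ≡⟨ /-cong (falling (ℤ.suc n) (suc j)) (cong (suc j ℕ.*_) j!≡suc-d) ⟩
  falling (ℤ.suc n) (suc j) / (suc j ℕ.* suc d)
    ≡⟨ [b+sc]/sd≡b/sd+c/d _ (falling n (suc j)) (falling n j) j d falling-recurrence ⟩
  falling n (suc j) / (suc j ℕ.* suc d) ℚ.+ falling n j / suc d
    ≡⟨ cong₂ ℚ._+_ (/-cong (falling n (suc j)) (cong (suc j ℕ.*_) (sym j!≡suc-d))) (/-cong (falling n j) (sym j!≡suc-d)) ⟩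
  binom n (suc j) ℚ.+ binom n j ∎
  where
  open ≡-Reasoning
  _/_ : ℤ → (q : ℕ) → .{{NonZero q}} → ℚ
  _/_ = ℚ._/_
  /-cong : ∀ a {q₁ q₂} .{{_ : NonZero q₁}} .{{_ : NonZero q₂}} → q₁ ≡ q₂ → a / q₁ ≡ a / q₂
  /-cong a refl = refl
  d = ℕ.pred (j !)
  instance
    j!≢0 : NonZero (j !)
    j!≢0 = j ℕP.!≢0
    [1+j]!≢0 : NonZero (suc j ℕ.* j !)
    [1+j]!≢0 = suc j ℕP.!≢0
  j!≡suc-d : j ! ≡ suc d
  j!≡suc-d = sym (ℕP.suc-pred (j !))
  rearrange : ∀ n j F → (+ 1 ℤ.+ n) ℤ.* F ≡ F ℤ.* (n ℤ.- j) ℤ.+ (+ 1 ℤ.+ j) ℤ.* F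
  rearrange = solve-∀
  falling-recurrence : falling (ℤ.suc n) (suc j) ≡ falling n (suc j) ℤ.+ + suc j ℤ.* falling n j
  falling-recurrence = trans (falling-suc n j) (rearrange n (+ j) (falling n j))

-- Formal ℚ[t]-linear combinations

matches : ℕ → Index → ℕ → Index → Bool
matches q k p κ = ⌊ (q ℕ.≟ p) ×-dec (LP.≡-dec ℕ._≟_ k κ) ⌋

-- does (suc q ≟ suc p) computes to does (q ≟ p); isYes alone does not.
matches-suc : ∀ q k p κ → matches (suc q) k (suc p) κ ≡ matches q k p κ
matches-suc q k p κ = trans (isYes≗does _) (sym (isYes≗does _))

coeff-++ : ∀ X Y p κ → coeff (X ++ Y) p κ ≡ coeff X p κ ℚ.+ coeff Y p κ
coeff-++ [] Y p κ = sym (ℚP.+-identityˡ _)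
coeff-++ ((c , q , k) ∷ X) Y p κ =
  trans (cong (c′ ℚ.+_) (coeff-++ X Y p κ)) (sym (ℚP.+-assoc c′ (coeff X p κ) (coeff Y p κ)))
  where c′ = if matches q k p κ then c else ℚ.0ℚ

coeff-negₗ : ∀ X p κ → coeff (negₗ X) p κ ≡ ℚ.- coeff X p κ
coeff-negₗ [] p κ = refl
coeff-negₗ ((c , q , k) ∷ X) p κ =
  trans (cong₂ ℚ._+_ (if-neg (matches q k p κ)) (coeff-negₗ X p κ)) (sym (ℚP.neg-distrib-+ (if matches q k p κ then c else ℚ.0ℚ) (coeff X p κ)))
  where
  if-neg : ∀ b → (if b then ℚ.- c else ℚ.0ℚ) ≡ ℚ.- (if b then c else ℚ.0ℚ)
  if-neg true  = refl
  if-neg false = refl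

coeff-tₗ-suc : ∀ X p κ → coeff (tₗ X) (suc p) κ ≡ coeff X p κ
coeff-tₗ-suc [] p κ = refl
coeff-tₗ-suc ((c , q , k) ∷ X) p κ =
  cong₂ (λ b z → (if b then c else ℚ.0ℚ) ℚ.+ z) (matches-suc q k p κ) (coeff-tₗ-suc X p κ)

coeff-tₗ-zero : ∀ X κ → coeff (tₗ X) 0 κ ≡ ℚ.0ℚ
coeff-tₗ-zero [] κ = refl
coeff-tₗ-zero ((c , q , k) ∷ X) κ = cong (ℚ.0ℚ ℚ.+_) (coeff-tₗ-zero X κ)

-- _≈_ unfolds to a function type, from which Agda cannot infer the two sides.
infix 4 _≋_
record _≋_ (X Y : LC) : Set where
  constructor mk≋
  field coeff-≡ : X ≈ Y
open _≋_

≋-isEquivalence : IsEquivalence _≋_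
≋-isEquivalence = record
  { refl  = mk≋ λ p κ → refl
  ; sym   = λ (mk≋ e) → mk≋ λ p κ → sym (e p κ)
  ; trans = λ (mk≋ e) (mk≋ f) → mk≋ λ p κ → trans (e p κ) (f p κ)
  }

≋-setoid : Setoid _ _
≋-setoid = record { isEquivalence = ≋-isEquivalence }

open Setoid ≋-setoid using () renaming (refl to ≋-refl; sym to ≋-sym; trans to ≋-trans; reflexive to ≋-reflexive)

module ≋-Reasoning = SetoidReasoning ≋-setoid

++-cong : ∀ {X X′ Y Y′} → X ≋ X′ → Y ≋ Y′ → X ++ Y ≋ X′ ++ Y′
++-cong {X} {X′} {Y} {Y′} (mk≋ e) (mk≋ f) = mk≋ λ p κ →
  trans (coeff-++ X Y p κ) (trans (cong₂ ℚ._+_ (e p κ) (f p κ)) (sym (coeff-++ X′ Y′ p κ)))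

negₗ-cong : ∀ {X Y} → X ≋ Y → negₗ X ≋ negₗ Y
negₗ-cong {X} {Y} (mk≋ e) = mk≋ λ p κ →
  trans (coeff-negₗ X p κ) (trans (cong ℚ.-_ (e p κ)) (sym (coeff-negₗ Y p κ)))

tₗ-cong : ∀ {X Y} → X ≋ Y → tₗ X ≋ tₗ Y
tₗ-cong {X} {Y} (mk≋ e) = mk≋ λ where
  zero κ    → trans (coeff-tₗ-zero X κ) (sym (coeff-tₗ-zero Y κ))
  (suc p) κ → trans (coeff-tₗ-suc X p κ) (trans (e p κ) (sym (coeff-tₗ-suc Y p κ)))

oneMinusT-cong : ∀ {X Y} → X ≋ Y → oneMinusT X ≋ oneMinusT Y
oneMinusT-cong eq = ++-cong eq (negₗ-cong (tₗ-cong eq))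

++-comm : ∀ X Y → X ++ Y ≋ Y ++ X
++-comm X Y = mk≋ λ p κ →
  trans (coeff-++ X Y p κ) (trans (ℚP.+-comm (coeff X p κ) _) (sym (coeff-++ Y X p κ)))

++-isCommutativeSemigroup : IsCommutativeSemigroup _≋_ _++_
++-isCommutativeSemigroup = record
  { isSemigroup = record
    { isMagma = record { isEquivalence = ≋-isEquivalence ; ∙-cong = ++-cong }
    ; assoc   = λ X Y Z → ≋-reflexive (LP.++-assoc X Y Z)
    }
  ; comm = ++-comm
  }

++-commutativeSemigroup : CommutativeSemigroup _ _
++-commutativeSemigroup = record { isCommutativeSemigroup = ++-isCommutativeSemigroup }

open import Algebra.Properties.CommutativeSemigroup ++-commutativeSemigroup using (interchange; xy∙z≈xz∙y)

term-≡ : ∀ {c c′ p p′ κ κ′} → c ≡ c′ → p ≡ p′ → κ ≡ κ′ → [ (c , p , κ) ] ≋ [ (c′ , p′ , κ′) ]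
term-≡ refl refl refl = ≋-refl

term-+ : ∀ c d q k → [ (c ℚ.+ d , q , k) ] ≋ [ (c , q , k) ] ++ [ (d , q , k) ]
term-+ c d q k = mk≋ λ p κ → split (matches q k p κ)
  where
  split : ∀ b → (if b then c ℚ.+ d else ℚ.0ℚ) ℚ.+ ℚ.0ℚ
              ≡ (if b then c else ℚ.0ℚ) ℚ.+ ((if b then d else ℚ.0ℚ) ℚ.+ ℚ.0ℚ)
  split true  = trans (ℚP.+-identityʳ _) (cong (c ℚ.+_) (sym (ℚP.+-identityʳ d)))
  split false = refl

term-0 : ∀ q k → [ (ℚ.0ℚ , q , k) ] ≋ []
term-0 q k = mk≋ λ p κ → vanish (matches q k p κ)
  where
  vanish : ∀ b → (if b then ℚ.0ℚ else ℚ.0ℚ) ℚ.+ ℚ.0ℚ ≡ ℚ.0ℚ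
  vanish true  = refl
  vanish false = refl

-- Linear identities between formal sums, checked coefficientwise with the ring solver.
infixl 6 _⊞_
infix 8 ⊟_
data LExpr : Set where
  atom : LC → LExpr
  _⊞_  : LExpr → LExpr → LExpr
  ⊟_   : LExpr → LExpr

⟦_⟧ : LExpr → LC
⟦ atom X ⟧ = X
⟦ e ⊞ f ⟧  = ⟦ e ⟧ ++ ⟦ f ⟧
⟦ ⊟ e ⟧    = negₗ ⟦ e ⟧

coeffExpr : ℕ → Index → LExpr → ℚ
coeffExpr p κ (atom X) = coeff X p κ
coeffExpr p κ (e ⊞ f)  = coeffExpr p κ e ℚ.+ coeffExpr p κ f
coeffExpr p κ (⊟ e)    = ℚ.- coeffExpr p κ e

coeff-⟦⟧ : ∀ p κ e → coeff ⟦ e ⟧ p κ ≡ coeffExpr p κ e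
coeff-⟦⟧ p κ (atom X) = refl
coeff-⟦⟧ p κ (e ⊞ f)  = trans (coeff-++ ⟦ e ⟧ ⟦ f ⟧ p κ) (cong₂ ℚ._+_ (coeff-⟦⟧ p κ e) (coeff-⟦⟧ p κ f))
coeff-⟦⟧ p κ (⊟ e)    = trans (coeff-negₗ ⟦ e ⟧ p κ) (cong ℚ.-_ (coeff-⟦⟧ p κ e))

≋-by-coeffs : ∀ e f → (∀ p κ → coeffExpr p κ e ≡ coeffExpr p κ f) → ⟦ e ⟧ ≋ ⟦ f ⟧
≋-by-coeffs e f eq = mk≋ λ p κ → trans (coeff-⟦⟧ p κ e) (trans (eq p κ) (sym (coeff-⟦⟧ p κ f)))

concatMap-concatMap : ∀ (f : B → List C) (g : A → List B) xs →
  concatMap f (concatMap g xs) ≡ concatMap (concatMap f ∘ g) xs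
concatMap-concatMap f g [] = refl
concatMap-concatMap f g (x ∷ xs) =
  trans (LP.concatMap-++ f (g x) _) (cong (concatMap f (g x) ++_) (concatMap-concatMap f g xs))

concatMap-[] : ∀ (xs : List A) → concatMap (λ _ → [] {A = B}) xs ≡ []
concatMap-[] []       = refl
concatMap-[] (_ ∷ xs) = concatMap-[] xs

map-as-concatMap : ∀ (f : A → B) xs → map f xs ≡ concatMap (λ x → [ f x ]) xs
map-as-concatMap f xs = trans (sym (LP.concatMap-pure (map f xs))) (LP.concatMap-map [_] f xs)

All-concatMap : ∀ {Q : A → Set} {P : B → Set} {f : A → List B} {xs} →
  All Q xs → (∀ x → Q x → All P (f x)) → All P (concatMap f xs)
All-concatMap []       h = []
All-concatMap (q ∷ qs) h = AllP.++⁺ (h _ q) (All-concatMap qs h)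

concatMap-cong-All : ∀ {P : A → Set} {f g : A → List B} {xs} →
  All P xs → (∀ x → P x → f x ≡ g x) → concatMap f xs ≡ concatMap g xs
concatMap-cong-All []         h = refl
concatMap-cong-All (px ∷ pxs) h = cong₂ _++_ (h _ px) (concatMap-cong-All pxs h)

concatMap-≋ : ∀ {P : A → Set} {F G : A → LC} {xs} →
  All P xs → (∀ x → P x → F x ≋ G x) → concatMap F xs ≋ concatMap G xs
concatMap-≋ []         h = ≋-refl
concatMap-≋ (px ∷ pxs) h = ++-cong (h _ px) (concatMap-≋ pxs h)

concatMap-vanishes : ∀ {P : A → Set} {F : A → LC} {xs} → All P xs → (∀ x → P x → F x ≋ []) → concatMap F xs ≋ []
concatMap-vanishes {xs = xs} all eq = ≋-trans (concatMap-≋ all eq) (≋-reflexive (concatMap-[] xs))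

concatMap-++-distrib : ∀ (F G : A → LC) xs →
  concatMap (λ x → F x ++ G x) xs ≋ concatMap F xs ++ concatMap G xs
concatMap-++-distrib F G []       = ≋-refl
concatMap-++-distrib F G (x ∷ xs) =
  ≋-trans (++-cong ≋-refl (concatMap-++-distrib F G xs)) (interchange (F x) (G x) _ _)

concatMap-oneMinusT : ∀ (F : A → LC) xs → concatMap (oneMinusT ∘ F) xs ≋ oneMinusT (concatMap F xs)
concatMap-oneMinusT F xs = ≋-trans (concatMap-++-distrib F (negₗ ∘ tₗ ∘ F) xs)
  (≋-reflexive (cong (concatMap F xs ++_) (sym (trans (cong negₗ (LP.map-concatMap _ F xs)) (LP.map-concatMap _ (tₗ ∘ F) xs)))))

oneMinusT-rearrange : ∀ Hu Hr Q R →
  (Hr ++ oneMinusT Q) ++ tₗ Hu ≋ Hu ⊕ₗ Hr ⊖ₗ oneMinusT (Hu ⊕ₗ R) ⊕ₗ oneMinusT (Q ⊕ₗ R)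
oneMinusT-rearrange Hu Hr Q R = ≋-trans
  (≋-by-coeffs
    ((atom Hr ⊞ (atom Q ⊞ ⊟ atom (tₗ Q))) ⊞ atom (tₗ Hu))
    (((atom Hu ⊞ atom Hr) ⊞ ⊟ ((atom Hu ⊞ atom R) ⊞ ⊟ (atom (tₗ Hu) ⊞ atom (tₗ R))))
      ⊞ ((atom Q ⊞ atom R) ⊞ ⊟ (atom (tₗ Q) ⊞ atom (tₗ R))))
    λ p κ → identity (coeff Hu p κ) (coeff Hr p κ) (coeff Q p κ) (coeff R p κ)
                     (coeff (tₗ Hu) p κ) (coeff (tₗ Q) p κ) (coeff (tₗ R) p κ))
  (≋-reflexive (cong₂ (λ X Y → ((Hu ++ Hr) ++ negₗ ((Hu ++ R) ++ negₗ X)) ++ ((Q ++ R) ++ negₗ Y))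
                      (sym (LP.map-++ _ Hu R)) (sym (LP.map-++ _ Q R))))
  where
  identity : ∀ hu hr q r thu tq tr →
    (hr ℚ.+ (q ℚ.+ ℚ.- tq)) ℚ.+ thu
      ≡ ((hu ℚ.+ hr) ℚ.+ ℚ.- ((hu ℚ.+ r) ℚ.+ ℚ.- (thu ℚ.+ tr))) ℚ.+ ((q ℚ.+ r) ℚ.+ ℚ.- (tq ℚ.+ tr))
  identity = solve 7 (λ hu hr q r thu tq tr →
    (hr :+ (q :+ :- tq)) :+ thu
      := ((hu :+ hr) :+ :- ((hu :+ r) :+ :- (thu :+ tr))) :+ ((q :+ r) :+ :- (tq :+ tr))) refl

-- f (m - 1), read as 0 when m = 0 (the convention h₋₁ = 0).
atPred : ℕ → (ℕ → LC) → LC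
atPred zero    f = []
atPred (suc m) f = f m

atPred-cong : ∀ m {F G : ℕ → LC} → (∀ i → F i ≋ G i) → atPred m F ≋ atPred m G
atPred-cong zero    eq = ≋-refl
atPred-cong (suc m) eq = eq m

atPred-++ : ∀ m (F G : ℕ → LC) → atPred m (λ i → F i ++ G i) ≡ atPred m F ++ atPred m G
atPred-++ zero    F G = refl
atPred-++ (suc m) F G = refl

++-atPred-++ : ∀ X m (F G : ℕ → LC) → X ++ atPred m (λ i → F i ++ G i) ≡ (X ++ atPred m F) ++ atPred m G
++-atPred-++ X m F G = trans (cong (X ++_) (atPred-++ m F G)) (sym (LP.++-assoc X (atPred m F) (atPred m G)))

atPred-[] : ∀ m → atPred m (λ _ → []) ≡ []
atPred-[] zero    = refl
atPred-[] (suc m) = refl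

atPred-map : ∀ m (G : LC → LC) → G [] ≡ [] → ∀ F → atPred m (G ∘ F) ≡ G (atPred m F)
atPred-map zero    G G[] F = sym G[]
atPred-map (suc m) G G[] F = refl

h₋≡atPred : ∀ m k → h₋ m k ≡ atPred m (λ i → h i k)
h₋≡atPred zero    k = refl
h₋≡atPred (suc m) k = refl

concatMap-atPred : ∀ m (F : A → ℕ → LC) xs → concatMap (λ x → atPred m (F x)) xs ≡ atPred m (λ i → concatMap (λ x → F x i) xs)
concatMap-atPred zero    F xs = concatMap-[] xs
concatMap-atPred (suc m) F xs = refl

-- Weak compositions

insertZero : ℕ → List ℕ → List ℕ
insertZero zero    u       = 0 ∷ u
insertZero (suc j) []      = 0 ∷ []
insertZero (suc j) (b ∷ u) = b ∷ insertZero j u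

incrementAt : ℕ → List ℕ → List ℕ
incrementAt j       []      = []
incrementAt zero    (x ∷ u) = suc x ∷ u
incrementAt (suc j) (x ∷ u) = x ∷ incrementAt j u

insertZero-at : ∀ j (e : List ℕ) r → length e ≡ j → insertZero j (e ++ r) ≡ e ++ 0 ∷ r
insertZero-at _ []      r refl = refl
insertZero-at _ (z ∷ e) r refl = cong (z ∷_) (insertZero-at _ e r refl)

incrementAt-at : ∀ j (e : List ℕ) x r → length e ≡ j → incrementAt j (e ++ x ∷ r) ≡ e ++ suc x ∷ r
incrementAt-at _ []      x r refl = refl
incrementAt-at _ (z ∷ e) x r refl = cong (z ∷_) (incrementAt-at _ e x r refl)

insertZero-end : ∀ j (u : List ℕ) → length u ≡ j → insertZero j u ≡ u ++ [ 0 ]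
insertZero-end j u len = trans (cong (insertZero j) (sym (LP.++-identityʳ u))) (insertZero-at j u [] len)

upTo-< : ∀ n → All (_< n) (upTo n)
upTo-< n = AllP.applyUpTo⁺₁ (λ i → i) n (λ i<n → i<n)

weakComps-length : ∀ n m → All (λ v → length v ≡ n) (weakComps n m)
weakComps-length zero    zero    = refl ∷ []
weakComps-length zero    (suc m) = []
weakComps-length (suc n) m       = All-concatMap (upTo-< (suc m))
  (λ a _ → AllP.map⁺ (All.map (cong suc) (weakComps-length n (m ∸ a))))

weakComps-zero : ∀ n → weakComps n 0 ≡ [ replicate n 0 ]
weakComps-zero zero    = refl
weakComps-zero (suc n) = trans (LP.++-identityʳ (map (0 ∷_) (weakComps n 0))) (cong (map (0 ∷_)) (weakComps-zero n))

insertZero-replicate : ∀ j n → j ≤ n → insertZero j (replicate n 0) ≡ replicate (suc n) 0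
insertZero-replicate zero    n       _         = refl
insertZero-replicate (suc j) (suc n) (s≤s j≤n) = cong (0 ∷_) (insertZero-replicate j n j≤n)

concatMap-weakComps-head : ∀ (G : List ℕ → List B) n m →
  concatMap G (weakComps (suc n) m) ≡ concatMap (λ a → concatMap (G ∘ (a ∷_)) (weakComps n (m ∸ a))) (upTo (suc m))
concatMap-weakComps-head G n m =
  trans (concatMap-concatMap G (λ a → map (a ∷_) (weakComps n (m ∸ a))) (upTo (suc m)))
        (LP.concatMap-cong (λ a → LP.concatMap-map G (a ∷_) (weakComps n (m ∸ a))) (upTo (suc m)))

weakComps-one : ∀ r → weakComps 1 r ≡ [ [ r ] ]
weakComps-one zero    = refl
weakComps-one (suc r) = begin
  concatMap (λ a → map (a ∷_) (weakComps 0 (suc r ∸ a))) (upTo (suc (suc r)))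
    ≡⟨ cong (concatMap (λ a → map (a ∷_) (weakComps 0 (suc r ∸ a)))) (sym (LP.map-upTo suc (suc r))) ⟩
  concatMap (λ a → map (a ∷_) (weakComps 0 (suc r ∸ a))) (map suc (upTo (suc r)))
    ≡⟨ LP.concatMap-map (λ a → map (a ∷_) (weakComps 0 (suc r ∸ a))) suc (upTo (suc r)) ⟩
  concatMap (λ a → map (suc a ∷_) (weakComps 0 (r ∸ a))) (upTo (suc r))
    ≡⟨ LP.concatMap-cong (λ a → LP.map-∘ (weakComps 0 (r ∸ a))) (upTo (suc r)) ⟩
  concatMap (λ a → map incHead (map (a ∷_) (weakComps 0 (r ∸ a)))) (upTo (suc r))
    ≡⟨ LP.map-concatMap incHead (λ a → map (a ∷_) (weakComps 0 (r ∸ a))) (upTo (suc r)) ⟨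
  map incHead (weakComps 1 r)
    ≡⟨ cong (map incHead) (weakComps-one r) ⟩
  [ [ suc r ] ] ∎
  where
  open ≡-Reasoning
  incHead : List ℕ → List ℕ
  incHead = incrementAt 0

concatMap-weakComps-zero : ∀ j n → j ≤ n → (G : List ℕ → List B) →
  concatMap G (weakComps (suc n) 0) ≡ concatMap (G ∘ insertZero j) (weakComps n 0)
concatMap-weakComps-zero j n j≤n G
  rewrite weakComps-zero (suc n) | weakComps-zero n | insertZero-replicate j n j≤n = refl

-- A weak composition of m + 1 either has a zero in slot j (delete it) or not (decrement that slot).
concatMap-weakComps-suc : ∀ j n → j ≤ n → ∀ m (G : List ℕ → LC) →
  concatMap G (weakComps (suc n) (suc m))
    ≋ concatMap (G ∘ insertZero j) (weakComps n (suc m)) ++ concatMap (G ∘ incrementAt j) (weakComps (suc n) m)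
concatMap-weakComps-suc zero n _ m G = ≋-reflexive (begin
  concatMap G (weakComps (suc n) (suc m))
    ≡⟨ concatMap-weakComps-head G n (suc m) ⟩
  K 0 ++ concatMap K (applyUpTo suc (suc m))
    ≡⟨ cong (λ z → K 0 ++ concatMap K z) (sym (LP.map-upTo suc (suc m))) ⟩
  K 0 ++ concatMap K (map suc (upTo (suc m)))
    ≡⟨ cong (K 0 ++_) (LP.concatMap-map K suc (upTo (suc m))) ⟩
  K 0 ++ concatMap (λ a → concatMap (G ∘ (suc a ∷_)) (weakComps n (m ∸ a))) (upTo (suc m))
    ≡⟨ cong (K 0 ++_) (concatMap-weakComps-head (G ∘ incrementAt zero) n m) ⟨
  K 0 ++ concatMap (G ∘ incrementAt zero) (weakComps (suc n) m) ∎)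
  where
  open ≡-Reasoning
  K : ℕ → LC
  K a = concatMap (G ∘ (a ∷_)) (weakComps n (suc m ∸ a))
concatMap-weakComps-suc (suc j) (suc n) (s≤s j≤n) m G = begin
  concatMap G (weakComps (suc (suc n)) (suc m))
    ≡⟨ concatMap-weakComps-head G (suc n) (suc m) ⟩
  concatMap K (upTo (suc (suc m)))
    ≡⟨ cong (concatMap K) (LP.upTo-∷ʳ (suc m)) ⟨
  concatMap K (upTo (suc m) ++ [ suc m ])
    ≡⟨ LP.concatMap-++ K (upTo (suc m)) _ ⟩
  concatMap K (upTo (suc m)) ++ (K (suc m) ++ [])
    ≈⟨ ++-cong (concatMap-≋ (upTo-< (suc m)) split) (≋-reflexive (cong (_++ []) lastK)) ⟩
  concatMap (λ a → Ins a ++ Inc a) (upTo (suc m)) ++ (Ins (suc m) ++ [])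
    ≈⟨ ++-cong (concatMap-++-distrib Ins Inc (upTo (suc m))) ≋-refl ⟩
  (concatMap Ins (upTo (suc m)) ++ concatMap Inc (upTo (suc m))) ++ (Ins (suc m) ++ [])
    ≈⟨ xy∙z≈xz∙y (concatMap Ins (upTo (suc m))) (concatMap Inc (upTo (suc m))) _ ⟩
  (concatMap Ins (upTo (suc m)) ++ (Ins (suc m) ++ [])) ++ concatMap Inc (upTo (suc m))
    ≡⟨ cong₂ _++_ (sym (LP.concatMap-++ Ins (upTo (suc m)) _)) (sym (concatMap-weakComps-head (G ∘ incrementAt (suc j)) (suc n) m)) ⟩
  concatMap Ins (upTo (suc m) ++ [ suc m ]) ++ concatMap (G ∘ incrementAt (suc j)) (weakComps (suc (suc n)) m)
    ≡⟨ cong (λ z → concatMap Ins z ++ concatMap (G ∘ incrementAt (suc j)) (weakComps (suc (suc n)) m)) (LP.upTo-∷ʳ (suc m)) ⟩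
  concatMap Ins (upTo (suc (suc m))) ++ concatMap (G ∘ incrementAt (suc j)) (weakComps (suc (suc n)) m)
    ≡⟨ cong (_++ concatMap (G ∘ incrementAt (suc j)) (weakComps (suc (suc n)) m)) (concatMap-weakComps-head (G ∘ insertZero (suc j)) n (suc m)) ⟨
  concatMap (G ∘ insertZero (suc j)) (weakComps (suc n) (suc m)) ++ concatMap (G ∘ incrementAt (suc j)) (weakComps (suc (suc n)) m) ∎
  where
  open ≋-Reasoning
  K Ins Inc : ℕ → LC
  K a   = concatMap (G ∘ (a ∷_)) (weakComps (suc n) (suc m ∸ a))
  Ins a = concatMap (G ∘ (a ∷_) ∘ insertZero j) (weakComps n (suc m ∸ a))
  Inc a = concatMap (G ∘ (a ∷_) ∘ incrementAt j) (weakComps (suc n) (m ∸ a))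
  lastK : K (suc m) ≡ Ins (suc m)
  lastK rewrite ℕP.n∸n≡0 m = concatMap-weakComps-zero j n j≤n (G ∘ (suc m ∷_))
  split : ∀ a → a < suc m → K a ≋ Ins a ++ Inc a
  split a (s≤s a≤m) rewrite ℕP.+-∸-assoc 1 a≤m = concatMap-weakComps-suc j n j≤n (m ∸ a) (G ∘ (a ∷_))

concatMap-weakComps : ∀ j n → j ≤ n → ∀ m (G : List ℕ → LC) →
  concatMap G (weakComps (suc n) m)
    ≋ concatMap (G ∘ insertZero j) (weakComps n m) ++ atPred m (λ i → concatMap (G ∘ incrementAt j) (weakComps (suc n) i))
concatMap-weakComps j n j≤n zero    G =
  ≋-reflexive (trans (concatMap-weakComps-zero j n j≤n G) (sym (LP.++-identityʳ _)))
concatMap-weakComps j n j≤n (suc m) G = concatMap-weakComps-suc j n j≤n m G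

-- Decompositions into blocks

upLast : List Index → List Index
upLast []           = []
upLast (b ∷ [])     = up b ∷ []
upLast (b ∷ c ∷ cs) = b ∷ upLast (c ∷ cs)

appendLast : ℕ → List Index → List Index
appendLast a []           = []
appendLast a (b ∷ [])     = (b ++ [ a ]) ∷ []
appendLast a (b ∷ c ∷ cs) = b ∷ appendLast a (c ∷ cs)

upLast-snoc : ∀ d b → upLast (d ++ [ b ]) ≡ d ++ [ up b ]
upLast-snoc []          b = refl
upLast-snoc (c ∷ [])    b = refl
upLast-snoc (c ∷ c′ ∷ d) b = cong (c ∷_) (upLast-snoc (c′ ∷ d) b)

appendLast-snoc : ∀ a d b → appendLast a (d ++ [ b ]) ≡ d ++ [ b ++ [ a ] ]
appendLast-snoc a []           b = refl
appendLast-snoc a (c ∷ [])     b = refl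
appendLast-snoc a (c ∷ c′ ∷ d) b = cong (c ∷_) (appendLast-snoc a (c′ ∷ d) b)

FirstBlockStartsWith : ℕ → List Index → Set
FirstBlockStartsWith y d = ∃₂ λ c cs → d ≡ (y ∷ c) ∷ cs

blocks-head : ∀ y ys → All (FirstBlockStartsWith y) (blocks (y ∷ ys))
blocks-head y ys = All-concatMap {Q = λ _ → ⊤} (All.universal _ (blocks ys)) λ where
  []       _ → ([] , [] , refl) ∷ []
  (b ∷ bs) _ → ([] , b ∷ bs , refl) ∷ (b , bs , refl) ∷ []

blocks-up : ∀ x xs → blocks (up (x ∷ xs)) ≡ map upLast (blocks (x ∷ xs))
blocks-up x []       = refl
blocks-up x (y ∷ ys) = begin
  concatMap F (blocks (up (y ∷ ys)))                  ≡⟨ cong (concatMap F) (blocks-up y ys) ⟩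
  concatMap F (map upLast (blocks (y ∷ ys)))          ≡⟨ LP.concatMap-map F upLast (blocks (y ∷ ys)) ⟩
  concatMap (F ∘ upLast) (blocks (y ∷ ys))            ≡⟨ concatMap-cong-All (blocks-head y ys) commute ⟩
  concatMap (map upLast ∘ F) (blocks (y ∷ ys))        ≡⟨ LP.map-concatMap upLast F (blocks (y ∷ ys)) ⟨
  map upLast (concatMap F (blocks (y ∷ ys)))          ∎
  where
  open ≡-Reasoning
  F : List Index → List (List Index)
  F d = ([ x ] ∷ d) ∷ joinFirst x d
  commute : ∀ d → FirstBlockStartsWith y d → F (upLast d) ≡ map upLast (F d)
  commute _ (c , []     , refl) = refl
  commute _ (c , _ ∷ _  , refl) = refl

blocks-snoc : ∀ x xs a (G : List Index → LC) →
  concatMap G (blocks (x ∷ xs ++ [ a ])) ≋ concatMap (λ d → G (d ++ [ [ a ] ]) ++ G (appendLast a d)) (blocks (x ∷ xs))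
blocks-snoc x []       a G = ≋-reflexive (sym (LP.++-assoc (G ([ x ] ∷ [ a ] ∷ [])) (G ((x ∷ a ∷ []) ∷ [])) []))
blocks-snoc x (y ∷ ys) a G = begin
  concatMap G (concatMap F (blocks (y ∷ ys ++ [ a ])))              ≡⟨ concatMap-concatMap G F (blocks (y ∷ ys ++ [ a ])) ⟩
  concatMap G′ (blocks (y ∷ ys ++ [ a ]))                            ≈⟨ blocks-snoc y ys a G′ ⟩
  concatMap (λ d → G′ (d ++ [ [ a ] ]) ++ G′ (appendLast a d)) (blocks (y ∷ ys)) ≈⟨ concatMap-≋ (blocks-head y ys) regroup ⟩
  concatMap (concatMap H ∘ F) (blocks (y ∷ ys))                     ≡⟨ concatMap-concatMap H F (blocks (y ∷ ys)) ⟨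
  concatMap H (concatMap F (blocks (y ∷ ys)))                       ∎
  where
  open ≋-Reasoning
  F : List Index → List (List Index)
  F d = ([ x ] ∷ d) ∷ joinFirst x d
  G′ H : List Index → LC
  G′ d = concatMap G (F d)
  H d  = G (d ++ [ [ a ] ]) ++ G (appendLast a d)
  interchange′ : ∀ P Q R S → (P ++ (Q ++ [])) ++ (R ++ (S ++ [])) ≋ (P ++ R) ++ ((Q ++ S) ++ [])
  interchange′ P Q R S = begin
    (P ++ (Q ++ [])) ++ (R ++ (S ++ [])) ≡⟨ cong₂ (λ u v → (P ++ u) ++ (R ++ v)) (LP.++-identityʳ Q) (LP.++-identityʳ S) ⟩
    (P ++ Q) ++ (R ++ S)                 ≈⟨ interchange P Q R S ⟩
    (P ++ R) ++ (Q ++ S)                 ≡⟨ cong ((P ++ R) ++_) (LP.++-identityʳ (Q ++ S)) ⟨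
    (P ++ R) ++ ((Q ++ S) ++ [])         ∎
  regroup : ∀ d → FirstBlockStartsWith y d → G′ (d ++ [ [ a ] ]) ++ G′ (appendLast a d) ≋ concatMap H (F d)
  regroup _ (c , [] , refl) = interchange′
    (G ([ x ] ∷ (y ∷ c) ∷ [ a ] ∷ [])) (G ((x ∷ y ∷ c) ∷ [ a ] ∷ []))
    (G ([ x ] ∷ ((y ∷ c) ++ [ a ]) ∷ [])) (G ((x ∷ y ∷ c ++ [ a ]) ∷ []))
  regroup _ (c , c′ ∷ cs , refl) = interchange′
    (G ([ x ] ∷ (y ∷ c) ∷ (c′ ∷ cs) ++ [ [ a ] ])) (G ((x ∷ y ∷ c) ∷ (c′ ∷ cs) ++ [ [ a ] ]))
    (G ([ x ] ∷ (y ∷ c) ∷ appendLast a (c′ ∷ cs))) (G ((x ∷ y ∷ c) ∷ appendLast a (c′ ∷ cs)))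

record LastBlock (k : Index) (d : List Index) : Set where
  constructor lastBlock
  field
    init   : List Index
    last   : Index
    d≡     : d ≡ init ++ [ last ]
    last≢[] : last ≢ []
    dep≤wt : length last ≤ sum last
    init<k : length init < length k

private
  n≤m⇒1+n≤x+m : ∀ {x n m} → NonZero x → n ≤ m → suc n ≤ x ℕ.+ m
  n≤m⇒1+n≤x+m {suc x} {m = m} _ n≤m = s≤s (ℕP.≤-trans n≤m (ℕP.m≤n+m m x))

blocks-lastBlock : ∀ x xs → All NonZero (x ∷ xs) → All (LastBlock (x ∷ xs)) (blocks (x ∷ xs))
blocks-lastBlock x [] (x≢0 ∷ _) = lastBlock [] [ x ] refl (λ ()) (n≤m⇒1+n≤x+m x≢0 z≤n) (s≤s z≤n) ∷ []
blocks-lastBlock x (y ∷ ys) (x≢0 ∷ nz) = All-concatMap (blocks-lastBlock y ys nz) extend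
  where
  extend : ∀ d → LastBlock (y ∷ ys) d → All (LastBlock (x ∷ y ∷ ys)) (([ x ] ∷ d) ∷ joinFirst x d)
  extend _ (lastBlock [] b refl b≢[] dep≤wt _) =
    lastBlock [ [ x ] ] b refl b≢[] dep≤wt (s≤s (s≤s z≤n)) ∷
    lastBlock [] (x ∷ b) refl (λ ()) (n≤m⇒1+n≤x+m x≢0 dep≤wt) (s≤s z≤n) ∷ []
  extend _ (lastBlock (c ∷ cs) b refl b≢[] dep≤wt init<k) =
    lastBlock ([ x ] ∷ c ∷ cs) b refl b≢[] dep≤wt (s≤s init<k) ∷
    lastBlock ((x ∷ c) ∷ cs) b refl b≢[] dep≤wt (ℕP.m<n⇒m<1+n init<k) ∷ []

up-snoc : ∀ Z z → up (Z ++ [ z ]) ≡ Z ++ [ suc z ]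
up-snoc []          z = refl
up-snoc (x ∷ [])    z = refl
up-snoc (x ∷ y ∷ Z) z = cong (x ∷_) (up-snoc (y ∷ Z) z)

length-up : ∀ k → length (up k) ≡ length k
length-up []          = refl
length-up (x ∷ [])    = refl
length-up (x ∷ y ∷ k) = cong suc (length-up (y ∷ k))

sum-up : ∀ b → b ≢ [] → sum (up b) ≡ suc (sum b)
sum-up []          b≢[] = ⊥-elim (b≢[] refl)
sum-up (x ∷ [])    _    = refl
sum-up (x ∷ y ∷ b) _    = trans (cong (x ℕ.+_) (sum-up (y ∷ b) (λ ()))) (ℕP.+-suc x _)

sum-snoc : ∀ e x → sum (e ++ [ x ]) ≡ sum e ℕ.+ x
sum-snoc e x = trans (sum-++ e [ x ]) (cong (sum e ℕ.+_) (ℕP.+-identityʳ x))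

length-snoc : ∀ (d : List A) b → length (d ++ [ b ]) ≡ suc (length d)
length-snoc d b = trans (LP.length-++ d) (ℕP.+-comm (length d) 1)

take-++-length : ∀ (e r : List A) → take (length e) (e ++ r) ≡ e
take-++-length []      r = refl
take-++-length (z ∷ e) r = cong (z ∷_) (take-++-length e r)

drop-++-length : ∀ (e r : List A) → drop (length e) (e ++ r) ≡ r
drop-++-length []      r = refl
drop-++-length (z ∷ e) r = drop-++-length e r

++-split : ∀ a b (u : List A) → length u ≡ a ℕ.+ b →
  ∃₂ λ u₁ u₂ → u ≡ u₁ ++ u₂ × length u₁ ≡ a × length u₂ ≡ b
++-split zero    b u       eq = [] , u , refl , refl , eq
++-split (suc a) b (x ∷ u) eq with ++-split a b u (ℕP.suc-injective eq)
... | u₁ , u₂ , refl , l₁ , l₂ = x ∷ u₁ , u₂ , refl , cong suc l₁ , l₂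

snoc-split : ∀ {b} (u : List A) → length u ≡ suc b → ∃₂ λ u₀ y → u ≡ u₀ ++ [ y ] × length u₀ ≡ b
snoc-split u eq with initLast u
... | u₀ ∷ʳ′ y = u₀ , y , refl , ℕP.suc-injective (trans (sym (length-snoc u₀ y)) eq)

-- The flag of binTop (the paper's δ_{l′,1}) for the block following the blocks bs.
firstAfter : Bool → List Index → Bool
firstAfter f []      = f
firstAfter f (_ ∷ _) = false

blockBinom : Bool → Index → ℕ → ℚ
blockBinom f b x = binom (binTop f b x) x

binTop-cong : ∀ f b x b′ x′ → wt b ∸ dep b ℕ.+ x ≡ wt b′ ∸ dep b′ ℕ.+ x′ → binTop f b x ≡ binTop f b′ x′
binTop-cong f b x b′ x′ eq = cong (λ s → + (s ℕ.+ (if f then 1 else 0)) ℤ.- + 2) eq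

binTop-suc : ∀ f b x → binTop f b (suc x) ≡ ℤ.suc (binTop f b x)
binTop-suc f b x = trans (cong (λ s → + (s ℕ.+ (if f then 1 else 0)) ℤ.- + 2) (ℕP.+-suc (wt b ∸ dep b) x)) (shift (+ (wt b ∸ dep b ℕ.+ x ℕ.+ (if f then 1 else 0))))
  where
  shift : ∀ N → (+ 1 ℤ.+ N) ℤ.- + 2 ≡ + 1 ℤ.+ (N ℤ.- + 2)
  shift = solve-∀

wt∸dep-up : ∀ b → b ≢ [] → length b ≤ sum b → wt (up b) ∸ dep (up b) ≡ suc (wt b ∸ dep b)
wt∸dep-up b b≢[] dep≤wt = trans (cong₂ _∸_ (sum-up b b≢[]) (length-up b)) (ℕP.+-∸-assoc 1 dep≤wt)

blockBinom-pascal : ∀ f b x → b ≢ [] → length b ≤ sum b →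
  blockBinom f (up b) (suc x) ≡ blockBinom f b (suc x) ℚ.+ blockBinom f (up b) x
blockBinom-pascal f b x b≢[] dep≤wt = begin
  binom (binTop f (up b) (suc x)) (suc x)            ≡⟨ cong (λ z → binom z (suc x)) top-up-suc ⟩
  binom (ℤ.suc (binTop f b (suc x))) (suc x)         ≡⟨ binom-pascal (binTop f b (suc x)) x ⟩
  binom (binTop f b (suc x)) (suc x) ℚ.+ binom (binTop f b (suc x)) x
                                                     ≡⟨ cong (λ z → blockBinom f b (suc x) ℚ.+ binom z x) top-up ⟨
  blockBinom f b (suc x) ℚ.+ blockBinom f (up b) x   ∎
  where
  open ≡-Reasoning
  top-up : binTop f (up b) x ≡ binTop f b (suc x)
  top-up = binTop-cong f (up b) x b (suc x) (trans (cong (ℕ._+ x) (wt∸dep-up b b≢[] dep≤wt)) (sym (ℕP.+-suc (wt b ∸ dep b) x)))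
  top-up-suc : binTop f (up b) (suc x) ≡ ℤ.suc (binTop f b (suc x))
  top-up-suc = trans (binTop-suc f (up b) x) (cong ℤ.suc top-up)

prodBinoms-snoc : ∀ f bs (es : List ℕ) b x → length es ≡ length bs →
  prodBinoms f (bs ++ [ b ]) (es ++ [ x ]) ≡ prodBinoms f bs es ℚ.* blockBinom (firstAfter f bs) b x
prodBinoms-snoc f []        []       b x _ = trans (ℚP.*-identityʳ (blockBinom f b x)) (sym (ℚP.*-identityˡ (blockBinom f b x)))
prodBinoms-snoc f (b′ ∷ bs) (e ∷ es) b x eq =
  trans (cong (binom (binTop f b′ e) e ℚ.*_) (prodBinoms-snoc false bs es b x (ℕP.suc-injective eq)))
        (trans (cong (λ g → binom (binTop f b′ e) e ℚ.* (prodBinoms false bs es ℚ.* blockBinom g b x)) (firstAfter-false bs))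
               (sym (ℚP.*-assoc (binom (binTop f b′ e) e) (prodBinoms false bs es) _)))
  where
  firstAfter-false : ∀ bs → firstAfter false bs ≡ false
  firstAfter-false []      = refl
  firstAfter-false (_ ∷ _) = refl

zipWith3-snoc : ∀ {D : Set} (F : A → B → C → D) as bs cs a b c → length bs ≡ length as → length cs ≡ length as →
  zipWith3 F (as ++ [ a ]) (bs ++ [ b ]) (cs ++ [ c ]) ≡ zipWith3 F as bs cs ++ [ F a b c ]
zipWith3-snoc F []       []       []       a b c _  _  = refl
zipWith3-snoc F (a′ ∷ as) (b′ ∷ bs) (c′ ∷ cs) a b c eq eq′ =
  cong (F a′ b′ c′ ∷_) (zipWith3-snoc F as bs cs a b c (ℕP.suc-injective eq) (ℕP.suc-injective eq′))

entry : Index → ℕ → ℕ → ℕ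
entry b x y = wt b ℕ.+ x ℕ.+ y

hTerm-split : ∀ k d (e e′ : List ℕ) → length e ≡ length d →
  hTerm k d (e ++ e′) ≡ (prodBinoms true d e , length k ∸ length d ℕ.+ sum e , zipWith3 entry d e e′)
hTerm-split k d e e′ le =
  cong₂ (λ a b → (prodBinoms true d a , length k ∸ length d ℕ.+ sum a , zipWith3 entry d a b))
        (trans (cong (λ L → take L (e ++ e′)) (sym le)) (take-++-length e e′))
        (trans (cong (λ L → drop L (e ++ e′)) (sym le)) (drop-++-length e e′))

hTerm-last : ∀ k d b (e : List ℕ) x e′ y → length e ≡ length d → length e′ ≡ length d →
  hTerm k (d ++ [ b ]) (e ++ x ∷ (e′ ++ [ y ])) ≡
  ( prodBinoms true d e ℚ.* blockBinom (firstAfter true d) b x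
  , length k ∸ suc (length d) ℕ.+ (sum e ℕ.+ x)
  , zipWith3 entry d e e′ ++ [ entry b x y ] )
hTerm-last k d b e x e′ y le le′ = begin
  hTerm k (d ++ [ b ]) (e ++ x ∷ (e′ ++ [ y ]))
    ≡⟨ cong (hTerm k (d ++ [ b ])) (LP.++-assoc e [ x ] _) ⟨
  hTerm k (d ++ [ b ]) ((e ++ [ x ]) ++ (e′ ++ [ y ]))
    ≡⟨ hTerm-split k (d ++ [ b ]) (e ++ [ x ]) (e′ ++ [ y ]) (trans (length-snoc e x) (trans (cong suc le) (sym (length-snoc d b)))) ⟩
  ( prodBinoms true (d ++ [ b ]) (e ++ [ x ])
  , length k ∸ length (d ++ [ b ]) ℕ.+ sum (e ++ [ x ])
  , zipWith3 entry (d ++ [ b ]) (e ++ [ x ]) (e′ ++ [ y ]) )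
    ≡⟨ cong₂ _,_ (prodBinoms-snoc true d e b x le)
         (cong₂ _,_ (cong₂ (λ L s → length k ∸ L ℕ.+ s) (length-snoc d b) (sum-snoc e x))
                    (zipWith3-snoc entry d e e′ b x y le le′)) ⟩
  _ ∎
  where open ≡-Reasoning

-- 2 * suc l reduces to suc (2l+1 l).
2l+1 : ℕ → ℕ
2l+1 l = l ℕ.+ (suc l ℕ.+ 0)

-- For a decomposition into l + 1 blocks, the paper's e and e′ are e ++ [ x ] and e′ ++ [ y ];
-- LastSlots₀ describes the same data with the slot x deleted.
record LastSlots (l : ℕ) (w : List ℕ) : Set where
  constructor lastSlots
  field
    e      : List ℕ
    x      : ℕ
    e′     : List ℕ
    y      : ℕ
    w≡     : w ≡ e ++ x ∷ (e′ ++ [ y ])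
    len-e  : length e ≡ l
    len-e′ : length e′ ≡ l

record LastSlots₀ (l : ℕ) (u : List ℕ) : Set where
  constructor lastSlots₀
  field
    e      : List ℕ
    e′     : List ℕ
    y      : ℕ
    u≡     : u ≡ e ++ (e′ ++ [ y ])
    len-e  : length e ≡ l
    len-e′ : length e′ ≡ l

lastSlots₀-view : ∀ l u → length u ≡ 2l+1 l → LastSlots₀ l u
lastSlots₀-view l u eq with ++-split l (suc l ℕ.+ 0) u eq
... | e , r , refl , len-e , len-r with snoc-split r (trans len-r (cong suc (ℕP.+-identityʳ l)))
... | e′ , y , refl , len-e′ = lastSlots₀ e e′ y refl len-e len-e′

lastSlots-view : ∀ l w → length w ≡ suc (2l+1 l) → LastSlots l w
lastSlots-view l w eq with ++-split l (suc (suc l ℕ.+ 0)) w (trans eq (sym (ℕP.+-suc l _)))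
... | e , x ∷ r , refl , len-e , len-r with snoc-split r (trans (ℕP.suc-injective len-r) (cong suc (ℕP.+-identityʳ l)))
... | e′ , y , refl , len-e′ = lastSlots e x e′ y refl len-e len-e′

-- hDecomp written as a concatMap, which unfolds without a case split on d.
hAt : ℕ → Index → List Index → LC
hAt m k d = concatMap (λ v → [ hTerm k d v ]) (weakComps (2 ℕ.* length d) m)

hDecomp-∷ : ∀ m k c d → hDecomp m k (c ∷ d) ≡ hAt m k (c ∷ d)
hDecomp-∷ m k c d = map-as-concatMap (hTerm k (c ∷ d)) _

hDecomp-snoc : ∀ m k d b → hDecomp m k (d ++ [ b ]) ≡ hAt m k (d ++ [ b ])
hDecomp-snoc m k []      b = hDecomp-∷ m k b []
hDecomp-snoc m k (c ∷ d) b = hDecomp-∷ m k c (d ++ [ b ])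

hAt-snoc : ∀ m k d b → hAt m k (d ++ [ b ]) ≡ concatMap (λ v → [ hTerm k (d ++ [ b ]) v ]) (weakComps (suc (2l+1 (length d))) m)
hAt-snoc m k d b = cong (λ L → concatMap (λ v → [ hTerm k (d ++ [ b ]) v ]) (weakComps (2 ℕ.* L) m)) (length-snoc d b)

module RaisedLastBlock (k : Index) (d : List Index) (b : Index) (b≢[] : b ≢ []) (dep≤wt : length b ≤ sum b) where

  open ≋-Reasoning

  private
    l = length d
    n = 2l+1 l
    l≤n : l ≤ n
    l≤n = ℕP.m≤m+n l _
    L R T : List ℕ → LC
    L v = [ hTerm (up k) (d ++ [ up b ]) v ]
    R v = upₗ [ hTerm k (d ++ [ b ]) v ]
    T v = tₗ (upₗ (L v))
    sum-R : ∀ m → upₗ (hAt m k (d ++ [ b ])) ≡ concatMap R (weakComps (suc n) m)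
    sum-R m = trans (cong upₗ (hAt-snoc m k d b)) (LP.map-concatMap _ _ (weakComps (suc n) m))
    sum-T : ∀ m → tₗ (upₗ (hAt m (up k) (d ++ [ up b ]))) ≡ concatMap T (weakComps (suc n) m)
    sum-T m = trans (cong (tₗ ∘ upₗ) (hAt-snoc m (up k) d (up b)))
                    (trans (cong tₗ (LP.map-concatMap _ L (weakComps (suc n) m)))
                           (LP.map-concatMap _ (upₗ ∘ L) (weakComps (suc n) m)))
    up-last-entry : ∀ Z x y → up (Z ++ [ entry b x y ]) ≡ Z ++ [ entry (up b) x y ]
    up-last-entry Z x y = trans (up-snoc Z (entry b x y)) (cong (λ s → Z ++ [ s ℕ.+ x ℕ.+ y ]) (sym (sum-up b b≢[])))
    zero-slot : ∀ u → length u ≡ n → L (insertZero l u) ≋ R (insertZero l u)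
    zero-slot u len with lastSlots₀-view l u len
    ... | lastSlots₀ e e′ y refl len-e len-e′ = begin
      L (insertZero l u′)   ≡⟨ cong L (insertZero-at l e _ len-e) ⟩
      L (e ++ 0 ∷ e′ ++ [ y ]) ≡⟨ cong [_] (hTerm-last (up k) d (up b) e 0 e′ y len-e len-e′) ⟩
      _ ≈⟨ term-≡ refl (cong (λ L → L ∸ suc l ℕ.+ (sum e ℕ.+ 0)) (length-up k)) (sym (up-last-entry (zipWith3 entry d e e′) 0 y)) ⟩
      _ ≡⟨ cong (upₗ ∘ [_]) (hTerm-last k d b e 0 e′ y len-e len-e′) ⟨
      R (e ++ 0 ∷ e′ ++ [ y ]) ≡⟨ cong R (insertZero-at l e _ len-e) ⟨
      R (insertZero l u′)   ∎
      where
      u′ = e ++ e′ ++ [ y ]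
    positive-slot : ∀ w → length w ≡ suc n → L (incrementAt l w) ≋ R (incrementAt l w) ++ T w
    positive-slot w len with lastSlots-view l w len
    ... | lastSlots e x e′ y refl len-e len-e′ = begin
      L (incrementAt l w′)          ≡⟨ cong L (incrementAt-at l e x _ len-e) ⟩
      L (e ++ suc x ∷ e′ ++ [ y ])  ≡⟨ cong [_] (hTerm-last (up k) d (up b) e (suc x) e′ y len-e len-e′) ⟩
      [ (P ℚ.* blockBinom f (up b) (suc x) , length (up k) ∸ suc l ℕ.+ (sum e ℕ.+ suc x) , Z ++ [ entry (up b) (suc x) y ]) ]
        ≈⟨ term-≡ (trans (cong (P ℚ.*_) (blockBinom-pascal f b x b≢[] dep≤wt)) (ℚP.*-distribˡ-+ P _ _))
                  (cong (λ L → L ∸ suc l ℕ.+ (sum e ℕ.+ suc x)) (length-up k)) (sym (up-last-entry Z (suc x) y)) ⟩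
      [ (c₁ ℚ.+ c₂ , p , κ) ]        ≈⟨ term-+ c₁ c₂ p κ ⟩
      [ (c₁ , p , κ) ] ++ [ (c₂ , p , κ) ]
        ≡⟨ cong₂ _++_ (cong (upₗ ∘ [_]) (hTerm-last k d b e (suc x) e′ y len-e len-e′)) (cong₂ (λ q κ → [ (c₂ , q , κ) ]) p≡ κ≡) ⟨
      R (e ++ suc x ∷ e′ ++ [ y ]) ++ tₗ (upₗ [ (c₂ , length (up k) ∸ suc l ℕ.+ (sum e ℕ.+ x) , Z ++ [ entry (up b) x y ]) ])
        ≡⟨ cong₂ _++_ (cong R (incrementAt-at l e x _ len-e)) (cong (tₗ ∘ upₗ ∘ [_]) (hTerm-last (up k) d (up b) e x e′ y len-e len-e′)) ⟨
      R (incrementAt l w′) ++ T w′ ∎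
      where
      w′ = e ++ x ∷ e′ ++ [ y ]
      f = firstAfter true d
      P = prodBinoms true d e
      Z = zipWith3 entry d e e′
      c₁ = P ℚ.* blockBinom f b (suc x)
      c₂ = P ℚ.* blockBinom f (up b) x
      p = length k ∸ suc l ℕ.+ (sum e ℕ.+ suc x)
      κ = up (Z ++ [ entry b (suc x) y ])
      p≡ : suc (length (up k) ∸ suc l ℕ.+ (sum e ℕ.+ x)) ≡ p
      p≡ = trans (sym (ℕP.+-suc _ (sum e ℕ.+ x)))
                 (cong₂ ℕ._+_ (cong (_∸ suc l) (length-up k)) (sym (ℕP.+-suc (sum e) x)))
      κ≡ : up (Z ++ [ entry (up b) x y ]) ≡ κ
      κ≡ = cong (λ s → up (Z ++ [ s ℕ.+ y ])) (trans (cong (ℕ._+ x) (sum-up b b≢[])) (sym (ℕP.+-suc (sum b) x)))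

  hAt-upLast : ∀ m →
    hAt m (up k) (d ++ [ up b ]) ≋ upₗ (hAt m k (d ++ [ b ])) ++ atPred m (λ i → tₗ (upₗ (hAt i (up k) (d ++ [ up b ]))))
  hAt-upLast m = begin
    hAt m (up k) (d ++ [ up b ])
      ≡⟨ hAt-snoc m (up k) d (up b) ⟩
    concatMap L (weakComps (suc n) m)
      ≈⟨ concatMap-weakComps l n l≤n m L ⟩
    concatMap (L ∘ insertZero l) (weakComps n m) ++ atPred m (λ i → concatMap (L ∘ incrementAt l) (weakComps (suc n) i))
      ≈⟨ ++-cong (concatMap-≋ (weakComps-length n m) zero-slot)
                 (atPred-cong m λ i → ≋-trans (concatMap-≋ (weakComps-length (suc n) i) positive-slot)
                                              (concatMap-++-distrib (R ∘ incrementAt l) T (weakComps (suc n) i))) ⟩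
    concatMap (R ∘ insertZero l) (weakComps n m) ++ atPred m (λ i → concatMap (R ∘ incrementAt l) (weakComps (suc n) i) ++ concatMap T (weakComps (suc n) i))
      ≡⟨ ++-atPred-++ (concatMap (R ∘ insertZero l) (weakComps n m)) m _ _ ⟩
    (concatMap (R ∘ insertZero l) (weakComps n m) ++ atPred m (λ i → concatMap (R ∘ incrementAt l) (weakComps (suc n) i))) ++ atPred m (λ i → concatMap T (weakComps (suc n) i))
      ≈⟨ ++-cong (concatMap-weakComps l n l≤n m R) (atPred-cong m λ i → ≋-reflexive (sum-T i)) ⟨
    concatMap R (weakComps (suc n) m) ++ atPred m (λ i → tₗ (upₗ (hAt i (up k) (d ++ [ up b ]))))
      ≡⟨ cong (_++ atPred m (λ i → tₗ (upₗ (hAt i (up k) (d ++ [ up b ]))))) (sum-R m) ⟨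
    upₗ (hAt m k (d ++ [ b ])) ++ atPred m (λ i → tₗ (upₗ (hAt i (up k) (d ++ [ up b ])))) ∎

hAt-appendLast : ∀ k k′ d b b′ a → length k′ ≡ length k → suc (length d) ≤ length k →
  sum b ℕ.+ a ≡ suc (sum b′) → length b′ ≡ length b → ∀ m →
  hAt m (k ++ [ a ]) (d ++ [ b ++ [ a ] ]) ≋ tₗ (upₗ (hAt m k′ (d ++ [ b′ ])))
hAt-appendLast k k′ d b b′ a len-k′ d<k sum≡ len-b′ m = begin
  hAt m (k ++ [ a ]) (d ++ [ b ++ [ a ] ])  ≡⟨ hAt-snoc m (k ++ [ a ]) d (b ++ [ a ]) ⟩
  concatMap Jₗ (weakComps (suc n) m)        ≈⟨ concatMap-≋ (weakComps-length (suc n) m) slot ⟩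
  concatMap Jᵣ (weakComps (suc n) m)        ≡⟨ sum-Jᵣ ⟨
  tₗ (upₗ (hAt m k′ (d ++ [ b′ ])))         ∎
  where
  open ≋-Reasoning
  l = length d
  n = 2l+1 l
  Jₗ Jᵣ : List ℕ → LC
  Jₗ w  = [ hTerm (k ++ [ a ]) (d ++ [ b ++ [ a ] ]) w ]
  Jᵣ w = tₗ (upₗ [ hTerm k′ (d ++ [ b′ ]) w ])
  sum-Jᵣ : tₗ (upₗ (hAt m k′ (d ++ [ b′ ]))) ≡ concatMap Jᵣ (weakComps (suc n) m)
  sum-Jᵣ = trans (cong (tₗ ∘ upₗ) (hAt-snoc m k′ d b′))
                 (trans (cong tₗ (LP.map-concatMap _ _ (weakComps (suc n) m)))
                        (LP.map-concatMap _ _ (weakComps (suc n) m)))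
  sum-ba : sum (b ++ [ a ]) ≡ suc (sum b′)
  sum-ba = trans (sum-snoc b a) sum≡
  slot : ∀ w → length w ≡ suc n → Jₗ w ≋ Jᵣ w
  slot w len with lastSlots-view l w len
  ... | lastSlots e x e′ y refl len-e len-e′ = begin
    Jₗ w′ ≡⟨ cong [_] (hTerm-last (k ++ [ a ]) d (b ++ [ a ]) e x e′ y len-e len-e′) ⟩
    _    ≈⟨ term-≡ (cong (λ z → prodBinoms true d e ℚ.* binom z x) top≡) p≡ κ≡ ⟩
    _    ≡⟨ cong (tₗ ∘ upₗ ∘ [_]) (hTerm-last k′ d b′ e x e′ y len-e len-e′) ⟨
    Jᵣ w′ ∎
    where
    w′ = e ++ x ∷ e′ ++ [ y ]
    Z = zipWith3 entry d e e′
    top≡ : binTop (firstAfter true d) (b ++ [ a ]) x ≡ binTop (firstAfter true d) b′ x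
    top≡ = binTop-cong (firstAfter true d) (b ++ [ a ]) x b′ x
             (cong (ℕ._+ x) (cong₂ _∸_ sum-ba (trans (length-snoc b a) (cong suc (sym len-b′)))))
    p≡ : length (k ++ [ a ]) ∸ suc l ℕ.+ (sum e ℕ.+ x) ≡ suc (length k′ ∸ suc l ℕ.+ (sum e ℕ.+ x))
    p≡ = cong (ℕ._+ (sum e ℕ.+ x))
           (trans (cong (_∸ suc l) (length-snoc k a))
                  (trans (ℕP.+-∸-assoc 1 d<k) (cong (λ L → suc (L ∸ suc l)) (sym len-k′))))
    κ≡ : Z ++ [ entry (b ++ [ a ]) x y ] ≡ up (Z ++ [ entry b′ x y ])
    κ≡ = trans (cong (λ s → Z ++ [ s ℕ.+ x ℕ.+ y ]) sum-ba) (sym (up-snoc Z _))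

-- The decomposition b ∷ d is non-empty, so the new last block is never the first one.
module NewLastBlock (k : Index) (b : Index) (d : List Index) where

  open ≋-Reasoning

  private
    D  = b ∷ d
    l  = length D
    n  = l ℕ.+ (l ℕ.+ 0)
    N  = 2l+1 l
    N≡ : N ≡ suc n
    N≡ = ℕP.+-suc l (l ℕ.+ 0)
    l≤N : l ≤ N
    l≤N = ℕP.m≤m+n l _

    S S₂ RT : List ℕ → LC
    S w  = [ hTerm (right k) (D ++ [ [ 1 ] ]) w ]
    S₂ w = [ hTerm (k ++ [ 2 ]) (D ++ [ [ 2 ] ]) w ]
    RT u = rightₗ [ hTerm k D u ]

    length-right : length (right k) ≡ length (k ++ [ 2 ])
    length-right = trans (length-snoc k 1) (sym (length-snoc k 2))

    both-zero : ∀ u → length u ≡ n → S (insertZero l (insertZero n u)) ≋ RT u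
    both-zero u len with ++-split l (l ℕ.+ 0) u len
    ... | e , e′ , refl , len-e , len-e′ = begin
      S (insertZero l (insertZero n (e ++ e′))) ≡⟨ cong S inserted ⟩
      S (e ++ 0 ∷ e′ ++ [ 0 ])                  ≡⟨ cong [_] (hTerm-last (right k) D [ 1 ] e 0 e′ 0 len-e len-e″) ⟩
      _ ≈⟨ term-≡ (ℚP.*-identityʳ _) (cong₂ ℕ._+_ (cong (_∸ suc l) (length-snoc k 1)) (ℕP.+-identityʳ (sum e))) refl ⟩
      _ ≡⟨ cong (rightₗ ∘ [_]) (hTerm-split k D e e′ len-e) ⟨
      RT (e ++ e′) ∎
      where
      len-e″ : length e′ ≡ l
      len-e″ = trans len-e′ (ℕP.+-identityʳ l)
      inserted : insertZero l (insertZero n (e ++ e′)) ≡ e ++ 0 ∷ e′ ++ [ 0 ]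
      inserted = trans (cong (insertZero l) (trans (insertZero-end n (e ++ e′) (trans (LP.length-++ e) (cong₂ ℕ._+_ len-e len-e′)))
                                                   (LP.++-assoc e e′ [ 0 ])))
                       (insertZero-at l e _ len-e)

    zero-then-suc : ∀ u → length u ≡ suc n → S (insertZero l (incrementAt n u)) ≋ S₂ (insertZero l u)
    zero-then-suc u len with lastSlots₀-view l u (trans len (sym N≡))
    ... | lastSlots₀ e e′ y refl len-e len-e′ = begin
      S (insertZero l (incrementAt n u′))  ≡⟨ cong S inserted ⟩
      S (e ++ 0 ∷ e′ ++ [ suc y ])         ≡⟨ cong [_] (hTerm-last (right k) D [ 1 ] e 0 e′ (suc y) len-e len-e′) ⟩
      _ ≈⟨ term-≡ refl (cong (λ L → L ∸ suc l ℕ.+ (sum e ℕ.+ 0)) length-right) refl ⟩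
      _ ≡⟨ cong [_] (hTerm-last (k ++ [ 2 ]) D [ 2 ] e 0 e′ y len-e len-e′) ⟨
      S₂ (e ++ 0 ∷ e′ ++ [ y ])            ≡⟨ cong S₂ (insertZero-at l e _ len-e) ⟨
      S₂ (insertZero l u′)                 ∎
      where
      u′ = e ++ e′ ++ [ y ]
      len-ee′ : length (e ++ e′) ≡ n
      len-ee′ = trans (LP.length-++ e) (cong₂ ℕ._+_ len-e (trans len-e′ (sym (ℕP.+-identityʳ l))))
      inserted : insertZero l (incrementAt n u′) ≡ e ++ 0 ∷ e′ ++ [ suc y ]
      inserted = trans (cong (insertZero l) (trans (cong (incrementAt n) (sym (LP.++-assoc e e′ [ y ])))
                                             (trans (incrementAt-at n (e ++ e′) y [] len-ee′) (LP.++-assoc e e′ [ suc y ]))))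
                       (insertZero-at l e _ len-e)

    one-in-new-block : ∀ u → length u ≡ N → S (incrementAt l (insertZero l u)) ≋ negₗ (tₗ (S₂ (insertZero l u)))
    one-in-new-block u len with lastSlots₀-view l u len
    ... | lastSlots₀ e e′ y refl len-e len-e′ = begin
      S (incrementAt l (insertZero l u′))      ≡⟨ cong S incremented ⟩
      S (e ++ 1 ∷ e′ ++ [ y ])                 ≡⟨ cong [_] (hTerm-last (right k) D [ 1 ] e 1 e′ y len-e len-e′) ⟩
      _ ≈⟨ term-≡ (sym (ℚP.neg-distribʳ-* (prodBinoms true D e) ℚ.1ℚ)) p≡ refl ⟩
      _ ≡⟨ cong (negₗ ∘ tₗ ∘ [_]) (hTerm-last (k ++ [ 2 ]) D [ 2 ] e 0 e′ y len-e len-e′) ⟨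
      negₗ (tₗ (S₂ (e ++ 0 ∷ e′ ++ [ y ])))    ≡⟨ cong (negₗ ∘ tₗ ∘ S₂) (insertZero-at l e _ len-e) ⟨
      negₗ (tₗ (S₂ (insertZero l u′)))         ∎
      where
      u′ = e ++ e′ ++ [ y ]
      incremented : incrementAt l (insertZero l u′) ≡ e ++ 1 ∷ e′ ++ [ y ]
      incremented = trans (cong (incrementAt l) (insertZero-at l e _ len-e)) (incrementAt-at l e 0 _ len-e)
      p≡ : length (right k) ∸ suc l ℕ.+ (sum e ℕ.+ 1) ≡ suc (length (k ++ [ 2 ]) ∸ suc l ℕ.+ (sum e ℕ.+ 0))
      p≡ = trans (cong (λ L → L ∸ suc l ℕ.+ (sum e ℕ.+ 1)) length-right)
                 (trans (cong (length (k ++ [ 2 ]) ∸ suc l ℕ.+_) (ℕP.+-suc (sum e) 0)) (ℕP.+-suc _ _))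

    two-in-new-block : ∀ w → length w ≡ suc N → S (incrementAt l (incrementAt l w)) ≋ []
    two-in-new-block w len with lastSlots-view l w len
    ... | lastSlots e x e′ y refl len-e len-e′ = begin
      S (incrementAt l (incrementAt l w′))   ≡⟨ cong S incremented ⟩
      S (e ++ suc (suc x) ∷ e′ ++ [ y ])     ≡⟨ cong [_] (hTerm-last (right k) D [ 1 ] e (suc (suc x)) e′ y len-e len-e′) ⟩
      _                                      ≈⟨ term-≡ vanishes refl refl ⟩
      [ (ℚ.0ℚ , _ , _) ]                     ≈⟨ term-0 _ _ ⟩
      []                                     ∎
      where
      w′ = e ++ x ∷ e′ ++ [ y ]
      incremented : incrementAt l (incrementAt l w′) ≡ e ++ suc (suc x) ∷ e′ ++ [ y ]
      incremented = trans (cong (incrementAt l) (incrementAt-at l e x _ len-e)) (incrementAt-at l e (suc x) _ len-e)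
      vanishes : prodBinoms true D e ℚ.* blockBinom false [ 1 ] (suc (suc x)) ≡ ℚ.0ℚ
      vanishes = trans (cong (λ z → prodBinoms true D e ℚ.* binom z (suc (suc x))) (cong +_ (ℕP.+-identityʳ x)))
                       (trans (cong (prodBinoms true D e ℚ.*_) (binom-vanishes x (suc (suc x)) (ℕP.m≤n+m (suc x) 1)))
                              (ℚP.*-zeroʳ (prodBinoms true D e)))

    one-in-two-block : ∀ w → length w ≡ suc N → S₂ (incrementAt l w) ≋ []
    one-in-two-block w len with lastSlots-view l w len
    ... | lastSlots e x e′ y refl len-e len-e′ = begin
      S₂ (incrementAt l w′)                  ≡⟨ cong S₂ (incrementAt-at l e x _ len-e) ⟩
      S₂ (e ++ suc x ∷ e′ ++ [ y ])          ≡⟨ cong [_] (hTerm-last (k ++ [ 2 ]) D [ 2 ] e (suc x) e′ y len-e len-e′) ⟩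
      _                                      ≈⟨ term-≡ vanishes refl refl ⟩
      [ (ℚ.0ℚ , _ , _) ]                     ≈⟨ term-0 _ _ ⟩
      []                                     ∎
      where
      w′ = e ++ x ∷ e′ ++ [ y ]
      vanishes : prodBinoms true D e ℚ.* blockBinom false [ 2 ] (suc x) ≡ ℚ.0ℚ
      vanishes = trans (cong (λ z → prodBinoms true D e ℚ.* binom z (suc x)) (cong +_ (ℕP.+-identityʳ x)))
                       (trans (cong (prodBinoms true D e ℚ.*_) (binom-vanishes x (suc x) ℕP.≤-refl))
                              (ℚP.*-zeroʳ (prodBinoms true D e)))

    S₂₀ : List ℕ → LC
    S₂₀ = S₂ ∘ insertZero l

    hAt-two : ∀ i → hAt i (k ++ [ 2 ]) (D ++ [ [ 2 ] ]) ≋ concatMap S₂₀ (weakComps N i)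
    hAt-two i = begin
      hAt i (k ++ [ 2 ]) (D ++ [ [ 2 ] ])   ≡⟨ hAt-snoc i (k ++ [ 2 ]) D [ 2 ] ⟩
      concatMap S₂ (weakComps (suc N) i)    ≈⟨ concatMap-weakComps l N l≤N i S₂ ⟩
      concatMap S₂₀ (weakComps N i) ++ atPred i (λ j → concatMap (S₂ ∘ incrementAt l) (weakComps (suc N) j))
        ≈⟨ ++-cong ≋-refl (atPred-cong i λ j → concatMap-vanishes (weakComps-length (suc N) j) one-in-two-block) ⟩
      concatMap S₂₀ (weakComps N i) ++ atPred i (λ _ → [])
        ≡⟨ trans (cong (concatMap S₂₀ (weakComps N i) ++_) (atPred-[] i)) (LP.++-identityʳ _) ⟩
      concatMap S₂₀ (weakComps N i) ∎

    zero-in-new-block : ∀ m → concatMap (S ∘ insertZero l) (weakComps N m)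
      ≋ concatMap RT (weakComps n m) ++ atPred m (λ i → concatMap S₂₀ (weakComps N i))
    zero-in-new-block m = begin
      concatMap (S ∘ insertZero l) (weakComps N m)
        ≡⟨ cong (λ N′ → concatMap (S ∘ insertZero l) (weakComps N′ m)) N≡ ⟩
      concatMap (S ∘ insertZero l) (weakComps (suc n) m)
        ≈⟨ concatMap-weakComps n n ℕP.≤-refl m (S ∘ insertZero l) ⟩
      concatMap (S ∘ insertZero l ∘ insertZero n) (weakComps n m) ++ atPred m (λ i → concatMap (S ∘ insertZero l ∘ incrementAt n) (weakComps (suc n) i))
        ≈⟨ ++-cong (concatMap-≋ (weakComps-length n m) both-zero)
                   (atPred-cong m λ i → concatMap-≋ (weakComps-length (suc n) i) zero-then-suc) ⟩
      concatMap RT (weakComps n m) ++ atPred m (λ i → concatMap S₂₀ (weakComps (suc n) i))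
        ≡⟨ cong (λ N′ → concatMap RT (weakComps n m) ++ atPred m (λ i → concatMap S₂₀ (weakComps N′ i))) N≡ ⟨
      concatMap RT (weakComps n m) ++ atPred m (λ i → concatMap S₂₀ (weakComps N i)) ∎

    positive-in-new-block : ∀ i → concatMap (S ∘ incrementAt l) (weakComps (suc N) i)
      ≋ negₗ (tₗ (concatMap S₂₀ (weakComps N i)))
    positive-in-new-block i = begin
      concatMap (S ∘ incrementAt l) (weakComps (suc N) i)
        ≈⟨ concatMap-weakComps l N l≤N i (S ∘ incrementAt l) ⟩
      concatMap (S ∘ incrementAt l ∘ insertZero l) (weakComps N i) ++ atPred i (λ j → concatMap (S ∘ incrementAt l ∘ incrementAt l) (weakComps (suc N) j))
        ≈⟨ ++-cong (concatMap-≋ (weakComps-length N i) one-in-new-block)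
                   (atPred-cong i λ j → concatMap-vanishes (weakComps-length (suc N) j) two-in-new-block) ⟩
      concatMap (negₗ ∘ tₗ ∘ S₂₀) (weakComps N i) ++ atPred i (λ _ → [])
        ≡⟨ trans (cong (concatMap (negₗ ∘ tₗ ∘ S₂₀) (weakComps N i) ++_) (atPred-[] i)) (LP.++-identityʳ _) ⟩
      concatMap (negₗ ∘ tₗ ∘ S₂₀) (weakComps N i)
        ≡⟨ trans (cong negₗ (LP.map-concatMap _ S₂₀ (weakComps N i))) (LP.map-concatMap _ (tₗ ∘ S₂₀) (weakComps N i)) ⟨
      negₗ (tₗ (concatMap S₂₀ (weakComps N i))) ∎

  hAt-right : ∀ m → hAt m (right k) (D ++ [ [ 1 ] ])
    ≋ rightₗ (hAt m k D) ++ atPred m (λ i → oneMinusT (hAt i (k ++ [ 2 ]) (D ++ [ [ 2 ] ])))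
  hAt-right m = begin
    hAt m (right k) (D ++ [ [ 1 ] ])
      ≡⟨ hAt-snoc m (right k) D [ 1 ] ⟩
    concatMap S (weakComps (suc N) m)
      ≈⟨ concatMap-weakComps l N l≤N m S ⟩
    concatMap (S ∘ insertZero l) (weakComps N m) ++ atPred m (λ i → concatMap (S ∘ incrementAt l) (weakComps (suc N) i))
      ≈⟨ ++-cong (zero-in-new-block m) (atPred-cong m positive-in-new-block) ⟩
    (concatMap RT (weakComps n m) ++ atPred m X) ++ atPred m (negₗ ∘ tₗ ∘ X)
      ≡⟨ trans (LP.++-assoc (concatMap RT (weakComps n m)) _ _) (cong (concatMap RT (weakComps n m) ++_) (sym (atPred-++ m X (negₗ ∘ tₗ ∘ X)))) ⟩
    concatMap RT (weakComps n m) ++ atPred m (λ i → oneMinusT (X i))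
      ≈⟨ ++-cong (≋-reflexive (LP.map-concatMap _ _ (weakComps n m)))
                 (atPred-cong m λ i → ++-cong (hAt-two i) (negₗ-cong (tₗ-cong (hAt-two i)))) ⟨
    rightₗ (hAt m k D) ++ atPred m (λ i → oneMinusT (hAt i (k ++ [ 2 ]) (D ++ [ [ 2 ] ]))) ∎
    where
    X : ℕ → LC
    X i = concatMap S₂₀ (weakComps N i)

-- Summing over decompositions

h-one : ∀ m → h m [ 1 ] ≋ single [ suc m ]
h-one m = begin
  h m [ 1 ]                           ≡⟨ cong (_++ []) (map-as-concatMap (hTerm [ 1 ] [ [ 1 ] ]) (weakComps 2 m)) ⟩
  concatMap G (weakComps 2 m) ++ []   ≡⟨ LP.++-identityʳ _ ⟩
  concatMap G (weakComps 2 m)         ≈⟨ concatMap-weakComps 0 1 z≤n m G ⟩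
  concatMap (G ∘ insertZero 0) (weakComps 1 m) ++ atPred m (λ i → concatMap (G ∘ incrementAt 0) (weakComps 2 i))
    ≈⟨ ++-cong ≋-refl (atPred-cong m λ i → concatMap-vanishes (weakComps-length 2 i) first-positive) ⟩
  concatMap (G ∘ insertZero 0) (weakComps 1 m) ++ atPred m (λ _ → [])
    ≡⟨ cong₂ _++_ (cong (concatMap (G ∘ insertZero 0)) (weakComps-one m)) (atPred-[] m) ⟩
  (G (0 ∷ m ∷ []) ++ []) ++ []        ≡⟨ trans (LP.++-identityʳ _) (LP.++-identityʳ _) ⟩
  single [ suc m ]                    ∎
  where
  open ≋-Reasoning
  G : List ℕ → LC
  G v = [ hTerm [ 1 ] [ [ 1 ] ] v ]
  first-positive : ∀ w → length w ≡ 2 → G (incrementAt 0 w) ≋ []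
  first-positive (a ∷ c ∷ []) _ = ≋-trans (term-≡ vanishes refl refl) (term-0 _ _)
    where
    top≡ : binTop true [ 1 ] (suc a) ≡ + a
    top≡ rewrite ℕP.+-comm a 1 = refl
    vanishes : blockBinom true [ 1 ] (suc a) ℚ.* ℚ.1ℚ ≡ ℚ.0ℚ
    vanishes = trans (ℚP.*-identityʳ _) (trans (cong (λ z → binom z (suc a)) top≡) (binom-vanishes a (suc a) ℕP.≤-refl))

h-up : ∀ x xs → All NonZero (x ∷ xs) → ∀ m →
  h m (up (x ∷ xs)) ≋ upₗ (h m (x ∷ xs)) ++ tₗ (upₗ (h₋ m (up (x ∷ xs))))
h-up x xs nz m = begin
  h m (up k)
    ≡⟨ h-up-blocks m ⟩
  concatMap (hDecomp m (up k) ∘ upLast) (blocks k)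
    ≈⟨ concatMap-≋ (blocks-lastBlock x xs nz) per-decomposition ⟩
  concatMap (λ d → upₗ (hDecomp m k d) ++ atPred m (λ i → tₗ (upₗ (hDecomp i (up k) (upLast d))))) (blocks k)
    ≈⟨ concatMap-++-distrib (upₗ ∘ hDecomp m k) _ (blocks k) ⟩
  concatMap (upₗ ∘ hDecomp m k) (blocks k) ++ concatMap (λ d → atPred m (λ i → tₗ (upₗ (hDecomp i (up k) (upLast d))))) (blocks k)
    ≡⟨ cong₂ _++_ (LP.map-concatMap _ (hDecomp m k) (blocks k)) (sym (concatMap-atPred m (λ d i → tₗ (upₗ (hDecomp i (up k) (upLast d)))) (blocks k))) ⟨
  upₗ (h m k) ++ atPred m (λ i → concatMap (λ d → tₗ (upₗ (hDecomp i (up k) (upLast d)))) (blocks k))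
    ≈⟨ ++-cong ≋-refl (atPred-cong m λ i → ≋-reflexive (sym (t-up-blocks i))) ⟩
  upₗ (h m k) ++ atPred m (λ i → tₗ (upₗ (h i (up k))))
    ≡⟨ cong (upₗ (h m k) ++_) (trans (atPred-map m (tₗ ∘ upₗ) refl (λ i → h i (up k))) (cong (tₗ ∘ upₗ) (sym (h₋≡atPred m (up k))))) ⟩
  upₗ (h m k) ++ tₗ (upₗ (h₋ m (up k))) ∎
  where
  open ≋-Reasoning
  k = x ∷ xs
  h-up-blocks : ∀ i → h i (up k) ≡ concatMap (hDecomp i (up k) ∘ upLast) (blocks k)
  h-up-blocks i = trans (cong (concatMap (hDecomp i (up k))) (blocks-up x xs)) (LP.concatMap-map _ upLast (blocks k))
  t-up-blocks : ∀ i → tₗ (upₗ (h i (up k))) ≡ concatMap (λ d → tₗ (upₗ (hDecomp i (up k) (upLast d)))) (blocks k)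
  t-up-blocks i = trans (cong (tₗ ∘ upₗ) (h-up-blocks i))
                        (trans (cong tₗ (LP.map-concatMap _ _ (blocks k))) (LP.map-concatMap _ _ (blocks k)))
  per-decomposition : ∀ d → LastBlock k d →
    hDecomp m (up k) (upLast d) ≋ upₗ (hDecomp m k d) ++ atPred m (λ i → tₗ (upₗ (hDecomp i (up k) (upLast d))))
  per-decomposition _ (lastBlock d b refl b≢[] dep≤wt _) = begin
    hDecomp m (up k) (upLast (d ++ [ b ]))  ≡⟨ trans (cong (hDecomp m (up k)) (upLast-snoc d b)) (hDecomp-snoc m (up k) d (up b)) ⟩
    hAt m (up k) (d ++ [ up b ])            ≈⟨ RaisedLastBlock.hAt-upLast k d b b≢[] dep≤wt m ⟩
    upₗ (hAt m k (d ++ [ b ])) ++ atPred m (λ i → tₗ (upₗ (hAt i (up k) (d ++ [ up b ]))))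
      ≈⟨ ++-cong (≋-reflexive (cong upₗ (hDecomp-snoc m k d b)))
                 (atPred-cong m λ i → ≋-reflexive (cong (tₗ ∘ upₗ) (trans (cong (hDecomp i (up k)) (upLast-snoc d b)) (hDecomp-snoc i (up k) d (up b))))) ⟨
    upₗ (hDecomp m k (d ++ [ b ])) ++ atPred m (λ i → tₗ (upₗ (hDecomp i (up k) (upLast (d ++ [ b ]))))) ∎

module _ (x : ℕ) (xs : List ℕ) (nz : All NonZero (x ∷ xs)) where

  private
    k = x ∷ xs

    split-last : ∀ a m → h m (k ++ [ a ])
      ≋ concatMap (λ d → hDecomp m (k ++ [ a ]) (d ++ [ [ a ] ])) (blocks k) ++ concatMap (hDecomp m (k ++ [ a ]) ∘ appendLast a) (blocks k)
    split-last a m = ≋-trans (blocks-snoc x xs a (hDecomp m (k ++ [ a ]))) (concatMap-++-distrib _ _ (blocks k))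

    tₗ-upₗ-Σ : ∀ (F : List Index → LC) → concatMap (tₗ ∘ upₗ ∘ F) (blocks k) ≡ tₗ (upₗ (concatMap F (blocks k)))
    tₗ-upₗ-Σ F = sym (trans (cong tₗ (LP.map-concatMap _ F (blocks k))) (LP.map-concatMap _ (upₗ ∘ F) (blocks k)))

    append-one : ∀ m → concatMap (hDecomp m (right k) ∘ appendLast 1) (blocks k) ≋ tₗ (upₗ (h m k))
    append-one m = ≋-trans (concatMap-≋ (blocks-lastBlock x xs nz) per-decomposition) (≋-reflexive (tₗ-upₗ-Σ (hDecomp m k)))
      where
      per-decomposition : ∀ d → LastBlock k d → hDecomp m (right k) (appendLast 1 d) ≋ tₗ (upₗ (hDecomp m k d))
      per-decomposition _ (lastBlock d b refl _ _ d<k) = begin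
        hDecomp m (right k) (appendLast 1 (d ++ [ b ])) ≡⟨ trans (cong (hDecomp m (right k)) (appendLast-snoc 1 d b)) (hDecomp-snoc m (right k) d (b ++ [ 1 ])) ⟩
        hAt m (right k) (d ++ [ b ++ [ 1 ] ])           ≈⟨ hAt-appendLast k k d b b 1 refl d<k (ℕP.+-comm (sum b) 1) refl m ⟩
        tₗ (upₗ (hAt m k (d ++ [ b ])))                 ≡⟨ cong (tₗ ∘ upₗ) (hDecomp-snoc m k d b) ⟨
        tₗ (upₗ (hDecomp m k (d ++ [ b ])))             ∎
        where open ≋-Reasoning

    append-two : ∀ m → concatMap (hDecomp m (k ++ [ 2 ]) ∘ appendLast 2) (blocks k) ≋ tₗ (upₗ (h m (up k)))
    append-two m = begin
      concatMap (hDecomp m (k ++ [ 2 ]) ∘ appendLast 2) (blocks k)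
        ≈⟨ concatMap-≋ (blocks-lastBlock x xs nz) per-decomposition ⟩
      concatMap (tₗ ∘ upₗ ∘ hDecomp m (up k) ∘ upLast) (blocks k)
        ≡⟨ tₗ-upₗ-Σ (hDecomp m (up k) ∘ upLast) ⟩
      tₗ (upₗ (concatMap (hDecomp m (up k) ∘ upLast) (blocks k)))
        ≡⟨ cong (tₗ ∘ upₗ) (trans (cong (concatMap (hDecomp m (up k))) (blocks-up x xs)) (LP.concatMap-map _ upLast (blocks k))) ⟨
      tₗ (upₗ (h m (up k))) ∎
      where
      open ≋-Reasoning
      per-decomposition : ∀ d → LastBlock k d → hDecomp m (k ++ [ 2 ]) (appendLast 2 d) ≋ tₗ (upₗ (hDecomp m (up k) (upLast d)))
      per-decomposition _ (lastBlock d b refl b≢[] _ d<k) = begin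
        hDecomp m (k ++ [ 2 ]) (appendLast 2 (d ++ [ b ])) ≡⟨ trans (cong (hDecomp m (k ++ [ 2 ])) (appendLast-snoc 2 d b)) (hDecomp-snoc m (k ++ [ 2 ]) d (b ++ [ 2 ])) ⟩
        hAt m (k ++ [ 2 ]) (d ++ [ b ++ [ 2 ] ])
          ≈⟨ hAt-appendLast k (up k) d b (up b) 2 (length-up k) d<k (trans (ℕP.+-comm (sum b) 2) (cong suc (sym (sum-up b b≢[])))) (length-up b) m ⟩
        tₗ (upₗ (hAt m (up k) (d ++ [ up b ])))            ≡⟨ cong (tₗ ∘ upₗ) (trans (cong (hDecomp m (up k)) (upLast-snoc d b)) (hDecomp-snoc m (up k) d (up b))) ⟨
        tₗ (upₗ (hDecomp m (up k) (upLast (d ++ [ b ]))))  ∎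

    Sep₂ : ℕ → LC
    Sep₂ i = concatMap (λ d → hDecomp i (k ++ [ 2 ]) (d ++ [ [ 2 ] ])) (blocks k)

    new-block : ∀ m → concatMap (λ d → hDecomp m (right k) (d ++ [ [ 1 ] ])) (blocks k) ≋ rightₗ (h m k) ++ atPred m (oneMinusT ∘ Sep₂)
    new-block m = begin
      concatMap (λ d → hDecomp m (right k) (d ++ [ [ 1 ] ])) (blocks k)
        ≈⟨ concatMap-≋ (blocks-lastBlock x xs nz) per-decomposition ⟩
      concatMap (λ d → rightₗ (hDecomp m k d) ++ atPred m (λ i → oneMinusT (hDecomp i (k ++ [ 2 ]) (d ++ [ [ 2 ] ])))) (blocks k)
        ≈⟨ concatMap-++-distrib _ _ (blocks k) ⟩
      concatMap (rightₗ ∘ hDecomp m k) (blocks k) ++ concatMap (λ d → atPred m (λ i → oneMinusT (hDecomp i (k ++ [ 2 ]) (d ++ [ [ 2 ] ])))) (blocks k)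
        ≡⟨ cong₂ _++_ (sym (LP.map-concatMap _ (hDecomp m k) (blocks k)))
                      (concatMap-atPred m (λ d i → oneMinusT (hDecomp i (k ++ [ 2 ]) (d ++ [ [ 2 ] ]))) (blocks k)) ⟩
      rightₗ (h m k) ++ atPred m (λ i → concatMap (λ d → oneMinusT (hDecomp i (k ++ [ 2 ]) (d ++ [ [ 2 ] ]))) (blocks k))
        ≈⟨ ++-cong ≋-refl (atPred-cong m λ i → concatMap-oneMinusT (λ d → hDecomp i (k ++ [ 2 ]) (d ++ [ [ 2 ] ])) (blocks k)) ⟩
      rightₗ (h m k) ++ atPred m (oneMinusT ∘ Sep₂) ∎
      where
      open ≋-Reasoning
      via-hAt : ∀ c d → hDecomp m (right k) ((c ∷ d) ++ [ [ 1 ] ])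
        ≋ rightₗ (hDecomp m k (c ∷ d)) ++ atPred m (λ i → oneMinusT (hDecomp i (k ++ [ 2 ]) ((c ∷ d) ++ [ [ 2 ] ])))
      via-hAt c d = begin
        hDecomp m (right k) ((c ∷ d) ++ [ [ 1 ] ])  ≡⟨ hDecomp-snoc m (right k) (c ∷ d) [ 1 ] ⟩
        hAt m (right k) ((c ∷ d) ++ [ [ 1 ] ])      ≈⟨ NewLastBlock.hAt-right k c d m ⟩
        rightₗ (hAt m k (c ∷ d)) ++ atPred m (λ i → oneMinusT (hAt i (k ++ [ 2 ]) ((c ∷ d) ++ [ [ 2 ] ])))
          ≈⟨ ++-cong (≋-reflexive (cong rightₗ (hDecomp-∷ m k c d)))
                     (atPred-cong m λ i → ≋-reflexive (cong oneMinusT (hDecomp-snoc i (k ++ [ 2 ]) (c ∷ d) [ 2 ]))) ⟨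
        rightₗ (hDecomp m k (c ∷ d)) ++ atPred m (λ i → oneMinusT (hDecomp i (k ++ [ 2 ]) ((c ∷ d) ++ [ [ 2 ] ]))) ∎
      per-decomposition : ∀ d → LastBlock k d →
        hDecomp m (right k) (d ++ [ [ 1 ] ]) ≋ rightₗ (hDecomp m k d) ++ atPred m (λ i → oneMinusT (hDecomp i (k ++ [ 2 ]) (d ++ [ [ 2 ] ])))
      per-decomposition _ (lastBlock []       b refl _ _ _) = via-hAt b []
      per-decomposition _ (lastBlock (c ∷ cs) b refl _ _ _) = via-hAt c (cs ++ [ b ])

  h-right : ∀ m → h m (right k) ≋ upₗ (h m k) ⊕ₗ rightₗ (h m k) ⊖ₗ oneMinusT (h m (up k)) ⊕ₗ oneMinusT (h₋ m (up (right k)))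
  h-right m = begin
    h m (right k)
      ≈⟨ split-last 1 m ⟩
    concatMap (λ d → hDecomp m (right k) (d ++ [ [ 1 ] ])) (blocks k) ++ concatMap (hDecomp m (right k) ∘ appendLast 1) (blocks k)
      ≈⟨ ++-cong (new-block m) (append-one m) ⟩
    (rightₗ (h m k) ++ atPred m (oneMinusT ∘ Sep₂)) ++ tₗ (upₗ (h m k))
      ≡⟨ cong (λ X → (rightₗ (h m k) ++ X) ++ tₗ (upₗ (h m k))) (atPred-map m oneMinusT refl Sep₂) ⟩
    (rightₗ (h m k) ++ oneMinusT (atPred m Sep₂)) ++ tₗ (upₗ (h m k))
      ≈⟨ oneMinusT-rearrange (upₗ (h m k)) (rightₗ (h m k)) (atPred m Sep₂) R ⟩
    upₗ (h m k) ⊕ₗ rightₗ (h m k) ⊖ₗ oneMinusT (upₗ (h m k) ⊕ₗ R) ⊕ₗ oneMinusT (atPred m Sep₂ ⊕ₗ R)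
      ≈⟨ ++-cong (++-cong (≋-refl {upₗ (h m k) ++ rightₗ (h m k)}) (negₗ-cong (oneMinusT-cong (h-up x xs nz m)))) (oneMinusT-cong shifted) ⟨
    upₗ (h m k) ⊕ₗ rightₗ (h m k) ⊖ₗ oneMinusT (h m (up k)) ⊕ₗ oneMinusT (h₋ m (up (right k))) ∎
    where
    open ≋-Reasoning
    R = tₗ (upₗ (h₋ m (up k)))
    shifted : h₋ m (up (right k)) ≋ atPred m Sep₂ ⊕ₗ R
    shifted = begin
      h₋ m (up (right k))                              ≡⟨ trans (h₋≡atPred m (up (right k))) (cong (λ K → atPred m (λ i → h i K)) (up-snoc k 1)) ⟩
      atPred m (λ i → h i (k ++ [ 2 ]))               ≈⟨ atPred-cong m (λ i → ≋-trans (split-last 2 i) (++-cong ≋-refl (append-two i))) ⟩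
      atPred m (λ i → Sep₂ i ++ tₗ (upₗ (h i (up k)))) ≡⟨ atPred-++ m Sep₂ (λ i → tₗ (upₗ (h i (up k)))) ⟩
      atPred m Sep₂ ++ atPred m (λ i → tₗ (upₗ (h i (up k))))
        ≡⟨ cong (atPred m Sep₂ ++_) (trans (atPred-map m (tₗ ∘ upₗ) refl (λ i → h i (up k))) (cong (tₗ ∘ upₗ) (sym (h₋≡atPred m (up k))))) ⟩
      atPred m Sep₂ ⊕ₗ R                               ∎

proposition3p2 : (k : Index) → k ≢ [] → All NonZero k → (m : ℕ) →
    (h m (1 ∷ []) ≈ single (suc m ∷ []))
    × (h m (up k) ≈ upₗ (h m k) ⊕ₗ tₗ (upₗ (h₋ m (up k))))
    × (h m (right k) ≈ upₗ (h m k) ⊕ₗ rightₗ (h m k) ⊖ₗ oneMinusT (h m (up k)) ⊕ₗ oneMinusT (h₋ m (up (right k))))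
proposition3p2 []       k≢[] _  m = ⊥-elim (k≢[] refl)
proposition3p2 (x ∷ xs) _    nz m = coeff-≡ (h-one m) , coeff-≡ (h-up x xs nz m) , coeff-≡ (h-right x xs nz m)
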